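{- For every integer $k\ge 1$ there is $\ell_0(k)$ such that the following holds for all $\ell \ge \ell_0(k)$ and all $p \ge 1$. Let $G = G_0 \supseteq G_1 \supseteq \dots \supseteq G_p$ be a $p$-extraction of a graph $G$ and let $K$ be an induced copy of $K_{\ell,\ell}$ in $G_p$. Let $P$ be a unimodal path (in some layer $i\in[p]$) with one end in $V(K)$, and let $u$ be a vertex not on $P$ that has a neighbour in $V(K)\setminus V(P)$. Then either $G$ contains a cycle with exactly $k$ chords, or $u$ has at most $8\sqrt{k}$ neighbours on $P$.
   Context: All graphs are finite and simple; $\chi$ denotes chromatic number. A chord of a cycle in $G$ is an edge of $G$ joining two non-consecutive vertices of the cycle. An extraction of a graph $G$ is an induced subgraph $G_1$ with $\chi(G_1)\ge\chi(G)/2$, every vertex of $G_1$ having a neighbour in $V(G)\setminus V(G_1)$, and such that for all distinct $x,y\in V(G_1)$ there is a path $P$ from $x$ to $y$ in $G$, induced except possibly for the edge $xy$, with interior in $V(G)\setminus V(G_1)$, and such that the vertices of $P$ other than $x,y$ and their neighbours on $P$ have no neighbours in $V(G_1)$ (a unimodal path with respect to $G_1$). A $p$-extraction is a sequence $G=G_0\supseteq G_1\supseteq\dots\supseteq G_p$ with $G_i$ an extraction of $G_{i-1}$. The $i$-th layer is $V(G_{i-1})\setminus V(G_i)$. A unimodal path in the $i$-th layer is a unimodal path in $G_{i-1}$ with respect to $G_i$ whose two ends lie in $V(G_p)$; its interior lies in the $i$-th layer. -}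

module Defs where

open import Data.Nat using (ℕ; zero; suc; _+_; _*_; _∸_; _≤_; _<_; _<ᵇ_; _≡ᵇ_)
open import Data.Bool using (Bool; true; false; T; _∧_; _∨_; not; if_then_else_)
open import Data.Fin using (Fin; toℕ)
open import Data.List using (List; []; _∷_; map; concatMap; allFin)
open import Data.Product using (Σ; _×_; _,_; ∃)
open import Data.Sum using (_⊎_)
open import Relation.Nullary using (¬_)
open import Relation.Binary.PropositionalEquality using (_≡_; _≢_)
open import Function.Definitions using (Injective)

record Graph : Set where
  field
    n      : ℕ
    adj    : Fin n → Fin n → Bool
    symm   : ∀ u v → adj u v ≡ adj v u
    irrefl : ∀ v → adj v v ≡ false

open Graph public

-- Vertex subsets of G (an induced subgraph is given by its vertex set).
VSet : Graph → Set
VSet G = Fin (n G) → Bool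

_⊆_ : {G : Graph} → VSet G → VSet G → Set
S₁ ⊆ S = ∀ v → T (S₁ v) → T (S v)

E : (G : Graph) → Fin (n G) → Fin (n G) → Set
E G u v = T (adj G u v)

Colourable : (G : Graph) → VSet G → ℕ → Set
Colourable G S c =
  Σ (Fin (n G) → ℕ) λ f →
    (∀ v → T (S v) → f v < c) ×
    (∀ u v → T (S u) → T (S v) → E G u v → f u ≢ f v)

IsChromaticNumber : (G : Graph) → VSet G → ℕ → Set
IsChromaticNumber G S c = Colourable G S c × (∀ d → Colourable G S d → c ≤ d)

count : List Bool → ℕ
count [] = 0
count (true ∷ bs) = suc (count bs)
count (false ∷ bs) = count bs

IsPathInducedExceptEnds : (G : Graph) → VSet G → Fin (n G) → Fin (n G) →
                          (m : ℕ) → (Fin m → Fin (n G)) → Set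
IsPathInducedExceptEnds G S x y m f =
  Injective _≡_ _≡_ f ×
  (∀ i → toℕ i ≡ 0 → f i ≡ x) ×
  (∀ i → suc (toℕ i) ≡ m → f i ≡ y) ×
  (∀ i → T (S (f i))) ×
  (∀ i j → toℕ j ≡ suc (toℕ i) → E G (f i) (f j)) ×
  (∀ i j → suc (suc (toℕ i)) ≤ toℕ j → E G (f i) (f j) →
     toℕ i ≡ 0 × suc (toℕ j) ≡ m)

IsUnimodal : (G : Graph) → (S S₁ : VSet G) → Fin (n G) → Fin (n G) →
             (m : ℕ) → (Fin m → Fin (n G)) → Set
IsUnimodal G S S₁ x y m f =
  T (S₁ x) × T (S₁ y) × x ≢ y ×
  IsPathInducedExceptEnds G S x y m f ×
  (∀ i → 0 < toℕ i → suc (toℕ i) < m → ¬ T (S₁ (f i))) ×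
  -- vertices other than the ends and their neighbours on P
  -- (positions 2 .. m-3) have no neighbour in V(G[S₁])
  (∀ i w → 2 ≤ toℕ i → toℕ i + 3 ≤ m → T (S₁ w) → ¬ E G (f i) w)

IsExtraction : (G : Graph) → (S S₁ : VSet G) → Set
IsExtraction G S S₁ =
  _⊆_ {G} S₁ S ×
  (∀ a b → IsChromaticNumber G S a → IsChromaticNumber G S₁ b → a ≤ 2 * b) ×
  (∀ v → T (S₁ v) → Σ (Fin (n G)) λ w → T (S w) × ¬ T (S₁ w) × E G v w) ×
  (∀ x y → T (S₁ x) → T (S₁ y) → x ≢ y →
     Σ ℕ λ m → Σ (Fin m → Fin (n G)) λ f → IsUnimodal G S S₁ x y m f)

-- p-extraction G = G_0 ⊇ G_1 ⊇ ... ⊇ G_p, G_i = G[S i]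
-- (values S i for i > p are irrelevant)
IsPExtraction : (G : Graph) → ℕ → (ℕ → VSet G) → Set
IsPExtraction G p S =
  (∀ v → T (S 0 v)) × (∀ i → i < p → IsExtraction G (S i) (S (suc i)))

-- Unimodal path in the (suc i)-th layer (i < p): unimodal in G_i w.r.t.
-- G_{i+1}, ends in V(G_p)
IsUnimodalInLayer : (G : Graph) → ℕ → (ℕ → VSet G) → ℕ →
                    Fin (n G) → Fin (n G) → (m : ℕ) → (Fin m → Fin (n G)) → Set
IsUnimodalInLayer G p S i x y m f =
  i < p × IsUnimodal G (S i) (S (suc i)) x y m f × T (S p x) × T (S p y)

IsInducedKll : (G : Graph) → VSet G → (ℓ : ℕ) → (a b : Fin ℓ → Fin (n G)) → Set
IsInducedKll G S ℓ a b =
  Injective _≡_ _≡_ a × Injective _≡_ _≡_ b ×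
  (∀ i j → a i ≢ b j) ×
  (∀ i → T (S (a i))) × (∀ i → T (S (b i))) ×
  (∀ i j → E G (a i) (b j)) ×
  (∀ i j → ¬ E G (a i) (a j)) ×
  (∀ i j → ¬ E G (b i) (b j))

InK : {G : Graph} {ℓ : ℕ} → (a b : Fin ℓ → Fin (n G)) → Fin (n G) → Set
InK a b v = (∃ λ i → v ≡ a i) ⊎ (∃ λ i → v ≡ b i)

cyclicConsecᵇ : ℕ → ℕ → ℕ → Bool
cyclicConsecᵇ m i j =
  (j ≡ᵇ suc i) ∨ (i ≡ᵇ suc j) ∨
  ((i ≡ᵇ 0) ∧ (suc j ≡ᵇ m)) ∨ ((j ≡ᵇ 0) ∧ (suc i ≡ᵇ m))

chordCount : (G : Graph) → (m : ℕ) → (Fin m → Fin (n G)) → ℕ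
chordCount G m f =
  count (concatMap (λ i → map (λ j →
           (toℕ i <ᵇ toℕ j) ∧ not (cyclicConsecᵇ m (toℕ i) (toℕ j)) ∧ adj G (f i) (f j))
         (allFin m)) (allFin m))

IsCycle : (G : Graph) → (m : ℕ) → (Fin m → Fin (n G)) → Set
IsCycle G m f =
  3 ≤ m × Injective _≡_ _≡_ f ×
  (∀ i j → T (cyclicConsecᵇ m (toℕ i) (toℕ j)) → E G (f i) (f j))

HasCycleWithExactlyChords : Graph → ℕ → Set
HasCycleWithExactlyChords G k =
  Σ ℕ λ m → Σ (Fin m → Fin (n G)) λ f → IsCycle G m f × chordCount G m f ≡ k

neighboursOnPath : (G : Graph) → Fin (n G) → (m : ℕ) → (Fin m → Fin (n G)) → ℕ
neighboursOnPath G u m f = count (map (λ i → adj G u (f i)) (allFin m))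

{-# OPTIONS --safe #-}
-- A cycle listed by distinct vertices C has exactly (edges spanned by C) − |C| chords, so it
-- suffices to build vertex lists whose spanned edges we can count. Let r be the number of
-- neighbours of u on P and suppose r² > 64k. If r ≥ k + 3, then u together with the stretch of P
-- between its first and (k + 2)-th neighbour of u is a cycle whose chords are exactly the k other
-- edges at u, because P is induced. Otherwise 8√k < r < k + 3. Orient P so that its first vertex
-- x lies in K and go around u – w – (t alternating pairs of K) – x – P – u, returning to u at the
-- (c + 1)-th neighbour of u on P. Since K lies in G_p ⊆ G_(i+1), unimodality says that the
-- vertices of P from the third to the third-to-last have no neighbour in K, so this cycle has
-- c + Z(t) chords, where t² ≤ Z(t) and Z(t + 1) ≤ Z(t) + 2t + 6. As c can be anything in
-- [1, r − 3] and r² > 64k, some t and c give exactly k chords. Taking ℓ₀ = k + 4 leaves k + 1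
-- vertices on each side of K that avoid x, u and w, enough for the alternating pairs.
module Submission where

open import Defs
open import Data.Nat
open import Data.Nat.Properties
open import Data.Nat.Tactic.RingSolver using (solve-∀)
open import Algebra.Properties.CommutativeSemigroup +-commutativeSemigroup using (interchange)
open import Data.Bool using (Bool; true; false; T; _∧_; _∨_; not)
open import Data.Bool.Properties using (T-≡; T-∨; T-∧)
open import Data.Fin using (Fin; toℕ; fromℕ<)
open import Data.Fin.Properties using (toℕ-injective; toℕ<n; toℕ-fromℕ<; fromℕ<-toℕ)
  renaming (_≟_ to _≟ᶠ_)
open import Data.List
  using (List; []; _∷_; _++_; map; length; reverse; concatMap; allFin; tabulate; cartesianProductWith; filter)
open import Data.List.Properties
  using (map-++; map-∘; map-cong; map-cong-local; length-map; length-++; ++-identityʳ; ++-assoc;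
         map-tabulate; length-tabulate; unfold-reverse; reverse-++; reverse-map; filter-all)
open import Data.List.Relation.Unary.All as All using (All; []; _∷_)
open import Data.List.Relation.Unary.All.Properties as All using ()
open import Data.List.Relation.Unary.AllPairs using ([]; _∷_)
open import Data.List.Relation.Unary.AllPairs.Properties as AllPairs using ()
open import Data.List.Relation.Unary.Unique.Propositional using (Unique)
open import Data.List.Relation.Unary.Unique.Propositional.Properties as Unique using ()
open import Data.Product using (Σ; _×_; _,_; proj₁; proj₂)
open import Data.Sum as Sum using (_⊎_; inj₁; inj₂)
open import Data.Empty using (⊥-elim)
open import Data.Unit using (⊤; tt)
open import Function using (_∘_; case_of_; Equivalence)
open import Relation.Nullary using (¬_; yes; no; ¬?)
open import Relation.Binary.PropositionalEquality

b2n : Bool → ℕ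
b2n true = 1
b2n false = 0

b2n≤1 : ∀ b → b2n b ≤ 1
b2n≤1 true = ≤-refl
b2n≤1 false = z≤n

T⇒≡true : ∀ {b} → T b → b ≡ true
T⇒≡true = Equivalence.to T-≡

¬T⇒≡false : ∀ {b} → ¬ T b → b ≡ false
¬T⇒≡false {true} ¬t = ⊥-elim (¬t tt)
¬T⇒≡false {false} _ = refl

≡ᵇ-true : ∀ {m n} → m ≡ n → (m ≡ᵇ n) ≡ true
≡ᵇ-true {m} {n} = T⇒≡true ∘ ≡⇒≡ᵇ m n

≡ᵇ-false : ∀ {m n} → m ≢ n → (m ≡ᵇ n) ≡ false
≡ᵇ-false {m} {n} m≢n = ¬T⇒≡false (m≢n ∘ ≡ᵇ⇒≡ m n)

<ᵇ-true : ∀ {m n} → m < n → (m <ᵇ n) ≡ true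
<ᵇ-true = T⇒≡true ∘ <⇒<ᵇ

<ᵇ-false : ∀ {m n} → n ≤ m → (m <ᵇ n) ≡ false
<ᵇ-false {m} {n} n≤m = ¬T⇒≡false (≤⇒≯ n≤m ∘ <ᵇ⇒< m n)

cyclicConsec-cases : ∀ m i j → T (cyclicConsecᵇ m i j) →
  j ≡ suc i ⊎ i ≡ suc j ⊎ (i ≡ 0 × suc j ≡ m) ⊎ (j ≡ 0 × suc i ≡ m)
cyclicConsec-cases m i j c with Equivalence.to (T-∨ {j ≡ᵇ suc i}) c
... | inj₁ a = inj₁ (≡ᵇ⇒≡ j (suc i) a)
... | inj₂ c₁ with Equivalence.to (T-∨ {i ≡ᵇ suc j}) c₁
...   | inj₁ b = inj₂ (inj₁ (≡ᵇ⇒≡ i (suc j) b))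
...   | inj₂ c₂ with Equivalence.to (T-∨ {(i ≡ᵇ 0) ∧ (suc j ≡ᵇ m)}) c₂
...     | inj₁ d = let (d₁ , d₂) = Equivalence.to (T-∧ {i ≡ᵇ 0}) d in
                   inj₂ (inj₂ (inj₁ (≡ᵇ⇒≡ i 0 d₁ , ≡ᵇ⇒≡ (suc j) m d₂)))
...     | inj₂ e = let (e₁ , e₂) = Equivalence.to (T-∧ {j ≡ᵇ 0}) e in
                   inj₂ (inj₂ (inj₂ (≡ᵇ⇒≡ j 0 e₁ , ≡ᵇ⇒≡ (suc i) m e₂)))

count-∷ : ∀ b bs → count (b ∷ bs) ≡ b2n b + count bs
count-∷ true bs = refl
count-∷ false bs = refl

count-++ : ∀ bs cs → count (bs ++ cs) ≡ count bs + count cs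
count-++ [] cs = refl
count-++ (true ∷ bs) cs = cong suc (count-++ bs cs)
count-++ (false ∷ bs) cs = count-++ bs cs

count≤length : ∀ bs → count bs ≤ length bs
count≤length [] = z≤n
count≤length (true ∷ bs) = s≤s (count≤length bs)
count≤length (false ∷ bs) = m≤n⇒m≤1+n (count≤length bs)

count-reverse : ∀ bs → count (reverse bs) ≡ count bs
count-reverse [] = refl
count-reverse (b ∷ bs) = begin
  count (reverse (b ∷ bs))       ≡⟨ cong count (unfold-reverse b bs) ⟩
  count (reverse bs ++ b ∷ [])   ≡⟨ count-++ (reverse bs) (b ∷ []) ⟩
  count (reverse bs) + count (b ∷ []) ≡⟨ cong₂ _+_ (count-reverse bs) (trans (count-∷ b []) (+-identityʳ (b2n b))) ⟩
  count bs + b2n b               ≡⟨ +-comm (count bs) (b2n b) ⟩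
  b2n b + count bs               ≡⟨ count-∷ b bs ⟨
  count (b ∷ bs)                 ∎
  where open ≡-Reasoning

module _ {A : Set} where

  count-map-cong : ∀ {F H : A → Bool} {xs} → All (λ x → F x ≡ H x) xs → count (map F xs) ≡ count (map H xs)
  count-map-cong = cong count ∘ map-cong-local

  count-map-true : ∀ {F : A → Bool} {xs} → All (λ x → F x ≡ true) xs → count (map F xs) ≡ length xs
  count-map-true [] = refl
  count-map-true {F} {x ∷ _} (p ∷ ps) = trans (count-∷ (F x) _) (cong₂ _+_ (cong b2n p) (count-map-true ps))

  count-map-false : ∀ {F : A → Bool} {xs} → All (λ x → F x ≡ false) xs → count (map F xs) ≡ 0
  count-map-false [] = refl
  count-map-false {F} {x ∷ _} (p ∷ ps) = trans (count-∷ (F x) _) (cong₂ _+_ (cong b2n p) (count-map-false ps))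

  count-map-+ : ∀ {F H K : A → Bool} {xs} → All (λ x → b2n (F x) + b2n (H x) ≡ b2n (K x)) xs →
                count (map F xs) + count (map H xs) ≡ count (map K xs)
  count-map-+ [] = refl
  count-map-+ {F} {H} {K} {x ∷ xs} (p ∷ ps) = begin
    count (F x ∷ map F xs) + count (H x ∷ map H xs)
      ≡⟨ cong₂ _+_ (count-∷ (F x) (map F xs)) (count-∷ (H x) (map H xs)) ⟩
    (b2n (F x) + count (map F xs)) + (b2n (H x) + count (map H xs))
      ≡⟨ interchange (b2n (F x)) _ _ _ ⟩
    (b2n (F x) + b2n (H x)) + (count (map F xs) + count (map H xs))
      ≡⟨ cong₂ _+_ p (count-map-+ ps) ⟩
    b2n (K x) + count (map K xs)
      ≡⟨ count-∷ (K x) (map K xs) ⟨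
    count (K x ∷ map K xs) ∎
    where open ≡-Reasoning

range : ℕ → ℕ → List ℕ
range s zero = []
range s (suc l) = s ∷ range (suc s) l

length-range : ∀ s l → length (range s l) ≡ l
length-range s zero = refl
length-range s (suc l) = cong suc (length-range (suc s) l)

range-++ : ∀ s a b → range s (a + b) ≡ range s a ++ range (s + a) b
range-++ s zero b = cong (λ z → range z b) (sym (+-identityʳ s))
range-++ s (suc a) b = cong (s ∷_) (trans (range-++ (suc s) a b) (cong (λ z → range (suc s) a ++ range z b) (sym (+-suc s a))))

range-∷ʳ : ∀ s l → range s (suc l) ≡ range s l ++ (s + l ∷ [])
range-∷ʳ s l = trans (cong (range s) (+-comm 1 l)) (range-++ s l 1)

all-range : ∀ {P : ℕ → Set} s l → (∀ j → s ≤ j → j < s + l → P j) → All P (range s l)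
all-range s zero _ = []
all-range s (suc l) p =
  p s ≤-refl (m<m+n s z<s) ∷
  all-range (suc s) l (λ j s<j j<s+1+l → p j (<⇒≤ s<j) (≤-trans j<s+1+l (≤-reflexive (sym (+-suc s l)))))

map-range-suc : ∀ {A : Set} (h : ℕ → A) s l → map h (range (suc s) l) ≡ map (h ∘ suc) (range s l)
map-range-suc h s zero = refl
map-range-suc h s (suc l) = cong (h (suc s) ∷_) (map-range-suc h (suc s) l)

map-suc-range : ∀ s l → map suc (range s l) ≡ range (suc s) l
map-suc-range s zero = refl
map-suc-range s (suc l) = cong (suc s ∷_) (map-suc-range (suc s) l)

map-toℕ-allFin : ∀ m → map toℕ (allFin m) ≡ range 0 m
map-toℕ-allFin zero = refl
map-toℕ-allFin (suc m) = cong (0 ∷_) (begin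
  map toℕ (tabulate Fin.suc)     ≡⟨ map-tabulate Fin.suc toℕ ⟩
  tabulate (suc ∘ toℕ)           ≡⟨ map-tabulate (λ i → i) (suc ∘ toℕ) ⟨
  map (suc ∘ toℕ) (allFin m)     ≡⟨ map-∘ (allFin m) ⟩
  map suc (map toℕ (allFin m))   ≡⟨ cong (map suc) (map-toℕ-allFin m) ⟩
  map suc (range 0 m)            ≡⟨ map-suc-range 0 m ⟩
  range 1 m                      ∎)
  where open ≡-Reasoning

map-reflect-range : ∀ m → map (λ j → m ∸ suc j) (range 0 m) ≡ reverse (range 0 m)
map-reflect-range zero = refl
map-reflect-range (suc m) = begin
  m ∷ map (λ j → suc m ∸ suc j) (range 1 m)   ≡⟨ cong (m ∷_) (map-range-suc (λ j → suc m ∸ suc j) 0 m) ⟩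
  m ∷ map (λ j → m ∸ suc j) (range 0 m)       ≡⟨ cong (m ∷_) (map-reflect-range m) ⟩
  m ∷ reverse (range 0 m)                     ≡⟨ reverse-++ (range 0 m) (m ∷ []) ⟨
  reverse (range 0 m ++ m ∷ [])               ≡⟨ cong reverse (range-∷ʳ 0 m) ⟨
  reverse (range 0 (suc m))                   ∎
  where open ≡-Reasoning

count-≡ᵇ-range : ∀ c s l → s ≤ c → c < s + l → count (map (_≡ᵇ c) (range s l)) ≡ 1
count-≡ᵇ-range c s zero s≤c c<s+0 = ⊥-elim (<-irrefl refl (≤-trans c<s+0 (≤-trans (≤-reflexive (+-identityʳ s)) s≤c)))
count-≡ᵇ-range c s (suc l) s≤c c<s+1+l with s ≟ c
... | yes refl rewrite ≡ᵇ-true (refl {x = s}) =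
  cong suc (count-map-false (all-range (suc s) l (λ j s<j _ → ≡ᵇ-false (>⇒≢ s<j))))
... | no s≢c rewrite ≡ᵇ-false s≢c =
  count-≡ᵇ-range c (suc s) l (≤∧≢⇒< s≤c s≢c) (≤-trans c<s+1+l (≤-reflexive (+-suc s l)))

count-suc-≡ᵇ-range : ∀ m → 1 ≤ m → count (map (λ j → suc j ≡ᵇ m) (range 0 m)) ≡ 1
count-suc-≡ᵇ-range (suc m) _ = count-≡ᵇ-range m 0 (suc m) z≤n ≤-refl

count-<ᵇ+count-≡ᵇ0 : ∀ m → 1 ≤ m → count (map (λ i → suc i <ᵇ m) (range 0 m)) + count (map (_≡ᵇ 0) (range 0 m)) ≡ m
count-<ᵇ+count-≡ᵇ0 (suc m) _ = begin
  count (map (λ i → suc i <ᵇ suc m) (range 0 (suc m))) + count (map (_≡ᵇ 0) (range 0 (suc m)))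
    ≡⟨ cong₂ (λ z c → count (map (λ i → i <ᵇ m) z) + c) (range-∷ʳ 0 m) (count-≡ᵇ-range 0 0 (suc m) z≤n z<s) ⟩
  count (map (λ i → i <ᵇ m) (range 0 m ++ m ∷ [])) + 1
    ≡⟨ cong (λ z → count z + 1) (map-++ (λ i → i <ᵇ m) (range 0 m) (m ∷ [])) ⟩
  count (map (λ i → i <ᵇ m) (range 0 m) ++ (m <ᵇ m) ∷ []) + 1
    ≡⟨ cong (_+ 1) (count-++ (map (λ i → i <ᵇ m) (range 0 m)) _) ⟩
  count (map (λ i → i <ᵇ m) (range 0 m)) + count ((m <ᵇ m) ∷ []) + 1
    ≡⟨ cong₂ (λ a b → a + count (b ∷ []) + 1)
         (trans (count-map-true (all-range 0 m (λ _ _ i<m → <ᵇ-true i<m))) (length-range 0 m))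
         (<ᵇ-false (≤-refl {m})) ⟩
  m + 0 + 1
    ≡⟨ trans (cong (_+ 1) (+-identityʳ m)) (+-comm m 1) ⟩
  suc m ∎
  where open ≡-Reasoning

nth : ∀ {A : Set} → A → List A → ℕ → A
nth d [] _ = d
nth d (x ∷ xs) zero = x
nth d (x ∷ xs) (suc j) = nth d xs j

module _ {A : Set} where

  map-nth-range : ∀ (d : A) xs → map (nth d xs) (range 0 (length xs)) ≡ xs
  map-nth-range d [] = refl
  map-nth-range d (x ∷ xs) = cong (x ∷_) (trans (map-range-suc (nth d (x ∷ xs)) 0 (length xs)) (map-nth-range d xs))

  nth-All : ∀ {P : A → Set} d {xs} → All P xs → ∀ j → j < length xs → P (nth d xs j)
  nth-All d (p ∷ _) zero _ = p
  nth-All d (_ ∷ ps) (suc j) (s≤s j<n) = nth-All d ps j j<n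

  nth-injective : ∀ (d : A) {xs} → Unique xs → ∀ i j → i < length xs → j < length xs → nth d xs i ≡ nth d xs j → i ≡ j
  nth-injective d _ zero zero _ _ _ = refl
  nth-injective d (x∉xs ∷ _) zero (suc j) _ (s≤s j<n) x≡ = ⊥-elim (nth-All d x∉xs j j<n x≡)
  nth-injective d (x∉xs ∷ _) (suc i) zero (s≤s i<n) _ ≡x = ⊥-elim (nth-All d x∉xs i i<n (sym ≡x))
  nth-injective d (_ ∷ xs!) (suc i) (suc j) (s≤s i<n) (s≤s j<n) eq = cong suc (nth-injective d xs! i j i<n j<n eq)

atℕ : ∀ {A : Set} (m : ℕ) → (Fin m → A) → A → ℕ → A
atℕ m f d j with j <? m
... | yes j<m = f (fromℕ< j<m)
... | no _ = d

module _ {A : Set} {m : ℕ} (f : Fin m → A) (d : A) where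

  atℕ-< : ∀ j (j<m : j < m) → atℕ m f d j ≡ f (fromℕ< j<m)
  atℕ-< j j<m with j <? m
  ... | yes _ = refl
  ... | no j≮m = ⊥-elim (j≮m j<m)

  atℕ-toℕ : ∀ i → atℕ m f d (toℕ i) ≡ f i
  atℕ-toℕ i = trans (atℕ-< (toℕ i) (toℕ<n i)) (cong f (fromℕ<-toℕ i (toℕ<n i)))

pairCount : ∀ {A : Set} → (A → A → Bool) → List A → List A → ℕ
pairCount F I J = count (cartesianProductWith F I J)

module _ {A : Set} where

  pairCount-∷ : ∀ (F : A → A → Bool) i I J → pairCount F (i ∷ I) J ≡ count (map (F i) J) + pairCount F I J
  pairCount-∷ F i I J = count-++ (map (F i) J) (cartesianProductWith F I J)

  concatMap≡cartesianProductWith : ∀ {B : Set} (F : A → A → Bool) (h : B → A) xs ys →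
    concatMap (λ x → map (λ y → F (h x) (h y)) ys) xs ≡ cartesianProductWith F (map h xs) (map h ys)
  concatMap≡cartesianProductWith F h [] ys = refl
  concatMap≡cartesianProductWith F h (x ∷ xs) ys =
    cong₂ _++_ (map-∘ ys) (concatMap≡cartesianProductWith F h xs ys)

  pairCount-+ : ∀ {F H K : A → A → Bool} {I J} →
    All (λ i → All (λ j → b2n (F i j) + b2n (H i j) ≡ b2n (K i j)) J) I →
    pairCount F I J + pairCount H I J ≡ pairCount K I J
  pairCount-+ [] = refl
  pairCount-+ {F} {H} {K} {i ∷ I} {J} (p ∷ ps) = begin
    pairCount F (i ∷ I) J + pairCount H (i ∷ I) J
      ≡⟨ cong₂ _+_ (pairCount-∷ F i I J) (pairCount-∷ H i I J) ⟩
    (count (map (F i) J) + pairCount F I J) + (count (map (H i) J) + pairCount H I J)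
      ≡⟨ interchange (count (map (F i) J)) _ _ _ ⟩
    (count (map (F i) J) + count (map (H i) J)) + (pairCount F I J + pairCount H I J)
      ≡⟨ cong₂ _+_ (count-map-+ p) (pairCount-+ ps) ⟩
    count (map (K i) J) + pairCount K I J
      ≡⟨ pairCount-∷ K i I J ⟨
    pairCount K (i ∷ I) J ∎
    where open ≡-Reasoning

  pairCount-rows : ∀ {F : A → A → Bool} {H : A → Bool} {I J} →
    All (λ i → count (map (F i) J) ≡ b2n (H i)) I → pairCount F I J ≡ count (map H I)
  pairCount-rows [] = refl
  pairCount-rows {F} {H} {i ∷ I} {J} (p ∷ ps) =
    trans (pairCount-∷ F i I J) (trans (cong₂ _+_ p (pairCount-rows ps)) (sym (count-∷ (H i) (map H I))))

  pairCount-false-column : ∀ {F : A → A → Bool} {j I J} →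
    All (λ i → F i j ≡ false) I → pairCount F I (j ∷ J) ≡ pairCount F I J
  pairCount-false-column [] = refl
  pairCount-false-column {F} {j} {i ∷ I} {J} (p ∷ ps) = begin
    pairCount F (i ∷ I) (j ∷ J)                       ≡⟨ pairCount-∷ F i I (j ∷ J) ⟩
    count (map (F i) (j ∷ J)) + pairCount F I (j ∷ J) ≡⟨ cong₂ _+_ (trans (count-∷ (F i j) (map (F i) J))
                                                                          (cong (λ b → b2n b + count (map (F i) J)) p))
                                                                   (pairCount-false-column ps) ⟩
    count (map (F i) J) + pairCount F I J             ≡⟨ pairCount-∷ F i I J ⟨
    pairCount F (i ∷ I) J                             ∎
    where open ≡-Reasoning

n≤n*n : ∀ t → t ≤ t * t
n≤n*n zero = z≤n
n≤n*n (suc t) = m≤m*n (suc t) (suc t)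

k≤t*t+R : ∀ k R t → 64 * k < (R + 3) * (R + 3) → 6 ≤ R → R + 3 ≤ 2 * t + 8 → k ≤ t * t + R
k≤t*t+R k R t 64k<[R+3]² 6≤R R+3≤2t+8 = <⇒≤ (*-cancelˡ-< 64 k (t * t + R) (begin-strict
  64 * k                              <⟨ 64k<[R+3]² ⟩
  (R + 3) * (R + 3)                   ≤⟨ *-mono-≤ R+3≤2t+8 R+3≤2t+8 ⟩
  (2 * t + 8) * (2 * t + 8)           ≡⟨ expand t ⟩
  4 * (t * t) + 32 * t + 64           ≤⟨ +-monoˡ-≤ 64 (+-monoʳ-≤ (4 * (t * t)) (*-monoʳ-≤ 32 (n≤n*n t))) ⟩
  4 * (t * t) + 32 * (t * t) + 64     ≤⟨ +-mono-≤ (≤-reflexive (collect (t * t))) (*-monoʳ-≤ 64 (≤-trans (s≤s z≤n) 6≤R)) ⟩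
  36 * (t * t) + 64 * R               ≤⟨ +-monoˡ-≤ (64 * R) (*-monoˡ-≤ (t * t) (m≤m+n 36 28)) ⟩
  64 * (t * t) + 64 * R               ≡⟨ *-distribˡ-+ 64 (t * t) R ⟨
  64 * (t * t + R)                    ∎))
  where
  open ≤-Reasoning
  expand : ∀ t → (2 * t + 8) * (2 * t + 8) ≡ 4 * (t * t) + 32 * t + 64
  expand = solve-∀
  collect : ∀ x → 4 * x + 32 * x ≡ 36 * x
  collect = solve-∀

-- The increments 2t + 6 stay at most R until t is about R / 2, and by then t * t ≥ k - R.
slow-growth-hits-window : ∀ k R (Z : ℕ → ℕ) → 64 * k < (R + 3) * (R + 3) → 6 ≤ R → Z 0 < k →
  (∀ t → t * t ≤ Z t) → (∀ t → Z (suc t) ≤ Z t + (2 * t + 6)) →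
  Σ ℕ λ t → Z t < k × k ≤ Z t + R
slow-growth-hits-window k R Z 64k<[R+3]² 6≤R Z0<k Z-lower Z-step = search k 0 refl Z0<k
  where
  search : ∀ fuel t → t + fuel ≡ k → Z t < k → Σ ℕ λ t → Z t < k × k ≤ Z t + R
  search zero t t+0≡k Zt<k =
    ⊥-elim (<⇒≱ (≤-<-trans (≤-trans (n≤n*n t) (Z-lower t)) Zt<k) (≤-reflexive (trans (sym t+0≡k) (+-identityʳ t))))
  search (suc fuel) t t+1+fuel≡k Zt<k with k ≤? Z t + R
  ... | yes k≤ = t , Zt<k , k≤
  ... | no k≰ with 2 * t + 6 ≤? R
  ...   | yes 2t+6≤R = search fuel (suc t) (trans (sym (+-suc t fuel)) t+1+fuel≡k)
                         (≤-<-trans (Z-step t) (≤-<-trans (+-monoʳ-≤ (Z t) 2t+6≤R) (≰⇒> k≰)))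
  ...   | no 2t+6≰R = ⊥-elim (k≰ (≤-trans (k≤t*t+R k R t 64k<[R+3]² 6≤R R+3≤2t+8) (+-monoˡ-≤ R (Z-lower t))))
    where
    R+3≤2t+8 : R + 3 ≤ 2 * t + 8
    R+3≤2t+8 = ≤-trans (≤-reflexive (+-comm R 3)) (≤-trans (s≤s (s≤s (≰⇒> 2t+6≰R))) (≤-reflexive (shift t)))
      where
      shift : ∀ t → 2 + (2 * t + 6) ≡ 2 * t + 8
      shift = solve-∀

64k<r*r⇒9≤r : ∀ k r → 1 ≤ k → 64 * k < r * r → 9 ≤ r
64k<r*r⇒9≤r k r 1≤k 64k<r*r with 9 ≤? r
... | yes 9≤r = 9≤r
... | no 9≰r = ⊥-elim (<-irrefl refl (≤-trans 64k<r*r (≤-trans (*-mono-≤ r≤8 r≤8) (*-monoʳ-≤ 64 1≤k))))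
  where
  r≤8 : r ≤ 8
  r≤8 = s≤s⁻¹ (≰⇒> 9≰r)

-- Degrees and spanned edges

module _ (G : Graph) where

  V : Set
  V = Fin (n G)

  E-sym : ∀ {u v} → E G u v → E G v u
  E-sym {u} {v} = subst T (symm G u v)

  deg : V → List V → ℕ
  deg v L = count (map (adj G v) L)

  edges : List V → ℕ
  edges [] = 0
  edges (v ∷ L) = deg v L + edges L

  cross : List V → List V → ℕ
  cross [] M = 0
  cross (v ∷ L) M = deg v M + cross L M

  deg-∷ : ∀ v z L → deg v (z ∷ L) ≡ b2n (adj G v z) + deg v L
  deg-∷ v z L = count-∷ (adj G v z) (map (adj G v) L)

  deg-++ : ∀ v L M → deg v (L ++ M) ≡ deg v L + deg v M
  deg-++ v L M = trans (cong count (map-++ (adj G v) L M)) (count-++ (map (adj G v) L) (map (adj G v) M))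

  deg≤length : ∀ v L → deg v L ≤ length L
  deg≤length v L = ≤-trans (count≤length (map (adj G v) L)) (≤-reflexive (length-map (adj G v) L))

  edges-++ : ∀ L M → edges (L ++ M) ≡ edges L + edges M + cross L M
  edges-++ [] M = sym (+-identityʳ (edges M))
  edges-++ (v ∷ L) M rewrite deg-++ v L M | edges-++ L M =
    shuffle (deg v L) (deg v M) (edges L) (edges M) (cross L M)
    where
    shuffle : ∀ a b c d e → a + b + (c + d + e) ≡ a + c + d + (b + e)
    shuffle = solve-∀

  cross-[] : ∀ L → cross L [] ≡ 0
  cross-[] [] = refl
  cross-[] (v ∷ L) = cross-[] L

  cross-∷ʳ : ∀ L z M → cross L (z ∷ M) ≡ deg z L + cross L M
  cross-∷ʳ [] z M = refl
  cross-∷ʳ (v ∷ L) z M rewrite deg-∷ v z M | cross-∷ʳ L z M | deg-∷ z v L | symm G v z =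
    shuffle (b2n (adj G z v)) (deg v M) (deg z L) (cross L M)
    where
    shuffle : ∀ a b c d → a + b + (c + d) ≡ a + c + (b + d)
    shuffle = solve-∀

  cross-const : ∀ L M t → All (λ v → deg v M ≡ t) L → cross L M ≡ length L * t
  cross-const [] M t [] = refl
  cross-const (v ∷ L) M t (p ∷ ps) = cong₂ _+_ p (cross-const L M t ps)

  -- Chords of a cycle

  module _ {m : ℕ} {g : ℕ → V} (m≥3 : 3 ≤ m)
           (consec : ∀ j → suc j < m → E G (g j) (g (suc j)))
           (close : ∀ j → suc j ≡ m → E G (g j) (g 0)) where

    cyclicConsec-adj : ∀ i j → i < m → j < m → T (cyclicConsecᵇ m i j) → E G (g i) (g j)
    cyclicConsec-adj i j i<m j<m c with cyclicConsec-cases m i j c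
    ... | inj₁ refl = consec i j<m
    ... | inj₂ (inj₁ refl) = E-sym (consec j i<m)
    ... | inj₂ (inj₂ (inj₁ (refl , j+1≡m))) = E-sym (close j j+1≡m)
    ... | inj₂ (inj₂ (inj₂ (refl , i+1≡m))) = close i i+1≡m

    chordᵇ consecᵇ adjᵇ : ℕ → ℕ → Bool
    chordᵇ i j = (i <ᵇ j) ∧ not (cyclicConsecᵇ m i j) ∧ adj G (g i) (g j)
    consecᵇ i j = (i <ᵇ j) ∧ cyclicConsecᵇ m i j
    adjᵇ i j = (i <ᵇ j) ∧ adj G (g i) (g j)

    chord+consec≡adj : ∀ i j → i < m → j < m → b2n (chordᵇ i j) + b2n (consecᵇ i j) ≡ b2n (adjᵇ i j)
    chord+consec≡adj i j i<m j<m with i <ᵇ j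
    ... | false = refl
    ... | true with cyclicConsecᵇ m i j in c
    ...   | false = +-identityʳ _
    ...   | true rewrite T⇒≡true (cyclicConsec-adj i j i<m j<m (subst T (sym c) tt)) = refl

    consec≡succ+wrap : ∀ i j → i < m → j < m →
      b2n (consecᵇ i j) ≡ b2n (j ≡ᵇ suc i) + b2n ((i ≡ᵇ 0) ∧ (suc j ≡ᵇ m))
    consec≡succ+wrap i j i<m j<m with j ≟ suc i
    consec≡succ+wrap zero .1 _ _ | yes refl rewrite ≡ᵇ-false (<⇒≢ m≥3) = refl
    consec≡succ+wrap (suc i) .(suc (suc i)) _ _ | yes refl rewrite <ᵇ-true (n<1+n i) | ≡ᵇ-true (refl {x = i}) = refl
    ... | no j≢1+i rewrite ≡ᵇ-false j≢1+i with i <? j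
    ...   | no i≮j rewrite <ᵇ-false (≮⇒≥ i≮j) = sym (wrap-false i j i≮j)
      where
      wrap-false : ∀ i j → ¬ i < j → b2n ((i ≡ᵇ 0) ∧ (suc j ≡ᵇ m)) ≡ 0
      wrap-false zero zero _ rewrite ≡ᵇ-false (<⇒≢ (≤-trans (s≤s (s≤s z≤n)) m≥3)) = refl
      wrap-false zero (suc j) i≮j = ⊥-elim (i≮j z<s)
      wrap-false (suc i) j _ = refl
    ...   | yes i<j rewrite <ᵇ-true i<j | ≡ᵇ-false (<⇒≢ (<-trans i<j (n<1+n j)))
                          | ≡ᵇ-false (>⇒≢ (≤-trans (s≤s z≤n) i<j))
            with (i ≡ᵇ 0) ∧ (suc j ≡ᵇ m)
    ...     | true = refl
    ...     | false = refl

    private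
      R : List ℕ
      R = range 0 m

      all-R : ∀ {P : ℕ → Set} → (∀ j → j < m → P j) → All P R
      all-R p = all-range 0 m (λ j _ j<m → p j j<m)

      succ-row : ∀ i → count (map (λ j → j ≡ᵇ suc i) R) ≡ b2n (suc i <ᵇ m)
      succ-row i with suc i <? m
      ... | yes i+1<m rewrite <ᵇ-true i+1<m = count-≡ᵇ-range (suc i) 0 m z≤n i+1<m
      ... | no i+1≮m rewrite <ᵇ-false (≮⇒≥ i+1≮m) =
        count-map-false (all-R (λ j j<m → ≡ᵇ-false (<⇒≢ (<-≤-trans j<m (≮⇒≥ i+1≮m)))))

      wrap-row : ∀ i → count (map (λ j → (i ≡ᵇ 0) ∧ (suc j ≡ᵇ m)) R) ≡ b2n (i ≡ᵇ 0)
      wrap-row zero = count-suc-≡ᵇ-range m (≤-trans (s≤s z≤n) m≥3)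
      wrap-row (suc i) = count-map-false (all-R (λ _ _ → refl))

    consec-pairs : pairCount consecᵇ R R ≡ m
    consec-pairs = begin
      pairCount consecᵇ R R
        ≡⟨ pairCount-+ (all-R (λ i i<m → all-R (λ j j<m → sym (consec≡succ+wrap i j i<m j<m)))) ⟨
      pairCount (λ i j → j ≡ᵇ suc i) R R + pairCount (λ i j → (i ≡ᵇ 0) ∧ (suc j ≡ᵇ m)) R R
        ≡⟨ cong₂ _+_ (pairCount-rows (all-R (λ i _ → succ-row i))) (pairCount-rows (all-R (λ i _ → wrap-row i))) ⟩
      count (map (λ i → suc i <ᵇ m) R) + count (map (_≡ᵇ 0) R)
        ≡⟨ count-<ᵇ+count-≡ᵇ0 m (≤-trans (s≤s z≤n) m≥3) ⟩
      m ∎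
      where open ≡-Reasoning

    adj-pairs : ∀ s l → pairCount adjᵇ (range s l) (range s l) ≡ edges (map g (range s l))
    adj-pairs s zero = refl
    adj-pairs s (suc l) = begin
      pairCount adjᵇ (s ∷ R′) (s ∷ R′)
        ≡⟨ pairCount-∷ adjᵇ s R′ (s ∷ R′) ⟩
      count (map (adjᵇ s) (s ∷ R′)) + pairCount adjᵇ R′ (s ∷ R′)
        ≡⟨ cong₂ _+_ head-row (pairCount-false-column (all-range (suc s) l λ i s<i _ → ∧-false-left (<ᵇ-false (<⇒≤ s<i)))) ⟩
      deg (g s) (map g R′) + pairCount adjᵇ R′ R′
        ≡⟨ cong (deg (g s) (map g R′) +_) (adj-pairs (suc s) l) ⟩
      deg (g s) (map g R′) + edges (map g R′) ∎
      where
      open ≡-Reasoning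
      R′ = range (suc s) l
      ∧-false-left : ∀ {a b} → a ≡ false → (a ∧ b) ≡ false
      ∧-false-left refl = refl
      head-row : count (map (adjᵇ s) (s ∷ R′)) ≡ deg (g s) (map g R′)
      head-row rewrite <ᵇ-false (≤-refl {s}) =
        trans (count-map-cong (all-range (suc s) l (λ j s<j _ → cong (_∧ adj G (g s) (g j)) (<ᵇ-true s<j))))
              (cong count (map-∘ R′))

    chords+length≡edges : pairCount chordᵇ R R + m ≡ edges (map g R)
    chords+length≡edges = begin
      pairCount chordᵇ R R + m                         ≡⟨ cong (pairCount chordᵇ R R +_) consec-pairs ⟨
      pairCount chordᵇ R R + pairCount consecᵇ R R     ≡⟨ pairCount-+ (all-R λ i i<m → all-R λ j → chord+consec≡adj i j i<m) ⟩
      pairCount adjᵇ R R                               ≡⟨ adj-pairs 0 m ⟩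
      edges (map g R)                                  ∎
      where open ≡-Reasoning

  Walk : V → List V → Set
  Walk v [] = ⊤
  Walk v (z ∷ L) = E G v z × Walk z L

  lastOr : V → List V → V
  lastOr v [] = v
  lastOr v (z ∷ L) = lastOr z L

  walk-++ : ∀ v L M → Walk v L → Walk (lastOr v L) M → Walk v (L ++ M)
  walk-++ v [] M _ w = w
  walk-++ v (z ∷ L) M (e , wL) wM = e , walk-++ z L M wL wM

  lastOr-++ : ∀ v L M → lastOr v (L ++ M) ≡ lastOr (lastOr v L) M
  lastOr-++ v [] M = refl
  lastOr-++ v (z ∷ L) M = lastOr-++ z L M

  nth-walk : ∀ d v L → Walk v L → ∀ j → j < length L → E G (nth d (v ∷ L) j) (nth d L j)
  nth-walk d v (z ∷ L) (e , _) zero _ = e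
  nth-walk d v (z ∷ L) (_ , w) (suc j) (s≤s j<n) = nth-walk d z L w j j<n

  nth-last : ∀ d v L → nth d (v ∷ L) (length L) ≡ lastOr v L
  nth-last d v [] = refl
  nth-last d v (z ∷ L) = nth-last d z L

  closedWalk⇒HasCycleWithExactlyChords : ∀ k h L → Walk h L → E G (lastOr h L) h → Unique (h ∷ L) → 2 ≤ length L →
    edges (h ∷ L) ≡ k + length (h ∷ L) → HasCycleWithExactlyChords G k
  closedWalk⇒HasCycleWithExactlyChords k h L walk closing unique 2≤len edges≡ =
    m , f , (m≥3 , f-injective , λ i j → cyclicConsec-adj m≥3 consec close (toℕ i) (toℕ j) (toℕ<n i) (toℕ<n j)) , chords≡k
    where
    m = length (h ∷ L)
    m≥3 : 3 ≤ m
    m≥3 = s≤s 2≤len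
    g = nth h (h ∷ L)
    f : Fin m → V
    f = g ∘ toℕ
    consec : ∀ j → suc j < m → E G (g j) (g (suc j))
    consec j (s≤s j<len) = nth-walk h h L walk j j<len
    close : ∀ j → suc j ≡ m → E G (g j) (g 0)
    close j refl = subst (λ z → E G z h) (sym (nth-last h h L)) closing
    f-injective : ∀ {i j} → f i ≡ f j → i ≡ j
    f-injective {i} {j} = toℕ-injective ∘ nth-injective h unique (toℕ i) (toℕ j) (toℕ<n i) (toℕ<n j)
    R = range 0 m
    chordCount≡pairCount : chordCount G m f ≡ pairCount (chordᵇ m≥3 consec close) R R
    chordCount≡pairCount =
      trans (cong count (concatMap≡cartesianProductWith (chordᵇ m≥3 consec close) toℕ (allFin m) (allFin m)))
            (cong (λ I → pairCount (chordᵇ m≥3 consec close) I I) (map-toℕ-allFin m))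
    chords≡k : chordCount G m f ≡ k
    chords≡k = +-cancelʳ-≡ m _ _ (begin
      chordCount G m f + m                             ≡⟨ cong (_+ m) chordCount≡pairCount ⟩
      pairCount (chordᵇ m≥3 consec close) R R + m      ≡⟨ chords+length≡edges m≥3 consec close ⟩
      edges (map g R)                                  ≡⟨ cong edges (map-nth-range h (h ∷ L)) ⟩
      edges (h ∷ L)                                    ≡⟨ edges≡ ⟩
      k + m                                            ∎)
      where open ≡-Reasoning

  record UnimodalPath (S₁ : VSet G) (m : ℕ) : Set where
    field
      Q : ℕ → V
      adjacent : ∀ j → suc j < m → E G (Q j) (Q (suc j))
      induced : ∀ i j → 2 + i ≤ j → j < m → E G (Q i) (Q j) → i ≡ 0 × suc j ≡ m
      injective : ∀ i j → i < m → j < m → Q i ≡ Q j → i ≡ j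
      middle-avoids-S₁ : ∀ j v → 2 ≤ j → j + 3 ≤ m → T (S₁ v) → ¬ E G (Q j) v
      interior-outside-S₁ : ∀ j → 0 < j → suc j < m → ¬ T (S₁ (Q j))

    seg : ℕ → ℕ → List V
    seg s l = map Q (range s l)

  module UnimodalPathProperties {S₁ : VSet G} {m : ℕ} (path : UnimodalPath S₁ m) where
    open UnimodalPath path

    length-seg : ∀ s l → length (seg s l) ≡ l
    length-seg s l = trans (length-map Q (range s l)) (length-range s l)

    all-seg : ∀ {P : V → Set} s l → (∀ j → s ≤ j → j < s + l → P (Q j)) → All P (seg s l)
    all-seg s l p = All.map⁺ (all-range s l p)

    deg-seg : ∀ v s l → deg v (seg s l) ≡ count (map (λ j → adj G v (Q j)) (range s l))
    deg-seg v s l = cong count (sym (map-∘ (range s l)))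

    walk-seg : ∀ s l → s + l < m → Walk (Q s) (seg (suc s) l)
    walk-seg s zero _ = tt
    walk-seg s (suc l) s+1+l<m =
      adjacent s (≤-trans (s≤s (s≤s (m≤m+n s l))) s+1+l<m′) , walk-seg (suc s) l s+1+l<m′
      where
      s+1+l<m′ : suc s + l < m
      s+1+l<m′ = ≤-trans (≤-reflexive (cong suc (sym (+-suc s l)))) s+1+l<m

    lastOr-seg : ∀ s l → lastOr (Q s) (seg (suc s) l) ≡ Q (s + l)
    lastOr-seg s zero = cong Q (sym (+-identityʳ s))
    lastOr-seg s (suc l) = trans (lastOr-seg (suc s) l) (cong Q (sym (+-suc s l)))

    unique-seg : ∀ s l → s + l ≤ m → Unique (seg s l)
    unique-seg s zero _ = []
    unique-seg s (suc l) s+1+l≤m =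
      all-seg (suc s) l (λ j s<j j<s+1+l Qs≡Qj →
        <⇒≢ s<j (injective s j (<-≤-trans (m<m+n s z<s) s+1+l≤m) (<-≤-trans j<s+1+l s+1+l≤m′) Qs≡Qj)) ∷
      unique-seg (suc s) l s+1+l≤m′
      where
      s+1+l≤m′ : suc s + l ≤ m
      s+1+l≤m′ = ≤-trans (≤-reflexive (sym (+-suc s l))) s+1+l≤m

    edges-seg : ∀ s l → s + l + 2 ≤ m → edges (seg s (suc l)) ≡ l
    edges-seg s zero _ = refl
    edges-seg s (suc l) bound = cong₂ _+_ head-deg (edges-seg (suc s) l (≤-trans (≤-reflexive shift) bound))
      where
      shift : suc s + l + 2 ≡ s + suc l + 2
      shift = cong (_+ 2) (sym (+-suc s l))
      j+1<m : ∀ j → j < suc (suc s) + l → suc j < m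
      j+1<m j j<s+2+l = ≤-trans (s≤s j<s+2+l) (≤-trans (≤-reflexive (rearrange s l)) bound)
        where
        rearrange : ∀ s l → suc (suc (suc s) + l) ≡ s + suc l + 2
        rearrange = solve-∀
      head-deg : deg (Q s) (seg (suc s) (suc l)) ≡ 1
      head-deg = begin
        deg (Q s) (Q (suc s) ∷ seg (suc (suc s)) l)
          ≡⟨ deg-∷ (Q s) (Q (suc s)) (seg (suc (suc s)) l) ⟩
        b2n (adj G (Q s) (Q (suc s))) + deg (Q s) (seg (suc (suc s)) l)
          ≡⟨ cong₂ _+_ (cong b2n (T⇒≡true (adjacent s (j+1<m s (s≤s (m≤n⇒m≤1+n (m≤m+n s l)))))))
                       (trans (deg-seg (Q s) (suc (suc s)) l) (count-map-false (all-range (suc (suc s)) l non-adjacent))) ⟩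
        1 ∎
        where
        open ≡-Reasoning
        non-adjacent : ∀ j → suc (suc s) ≤ j → j < suc (suc s) + l → adj G (Q s) (Q j) ≡ false
        non-adjacent j s+2≤j j<s+2+l = ¬T⇒≡false λ e →
          <⇒≢ (j+1<m j j<s+2+l) (proj₂ (induced s j s+2≤j (<-trans (n<1+n j) (j+1<m j j<s+2+l)) e))

    deg-seg-++ : ∀ v s a b → deg v (seg s (a + b)) ≡ deg v (seg s a) + deg v (seg (s + a) b)
    deg-seg-++ v s a b =
      trans (cong (deg v ∘ map Q) (range-++ s a b)) (trans (cong (deg v) (map-++ Q (range s a) _)) (deg-++ v (seg s a) _))

    deg-prefix-suc : ∀ v e → deg v (seg 0 (suc e)) ≡ deg v (seg 0 e) + b2n (adj G v (Q e))
    deg-prefix-suc v e = begin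
      deg v (seg 0 (suc e))                      ≡⟨ cong (deg v ∘ map Q) (range-∷ʳ 0 e) ⟩
      deg v (map Q (range 0 e ++ e ∷ []))        ≡⟨ cong (deg v) (map-++ Q (range 0 e) (e ∷ [])) ⟩
      deg v (seg 0 e ++ Q e ∷ [])                ≡⟨ deg-++ v (seg 0 e) (Q e ∷ []) ⟩
      deg v (seg 0 e) + deg v (Q e ∷ [])         ≡⟨ cong (deg v (seg 0 e) +_) (trans (deg-∷ v (Q e) []) (+-identityʳ _)) ⟩
      deg v (seg 0 e) + b2n (adj G v (Q e))      ∎
      where open ≡-Reasoning

    deg-prefix-mono : ∀ v {a b} → a ≤ b → deg v (seg 0 a) ≤ deg v (seg 0 b)
    deg-prefix-mono v {a} a≤b with m≤n⇒∃[o]m+o≡n a≤b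
    ... | o , refl = ≤-trans (m≤m+n (deg v (seg 0 a)) _) (≤-reflexive (sym (deg-seg-++ v 0 a o)))

    deg-prefix≤length : ∀ v e → deg v (seg 0 e) ≤ e
    deg-prefix≤length v e = ≤-trans (deg≤length v (seg 0 e)) (≤-reflexive (length-seg 0 e))

    RankedNeighbour : V → ℕ → ℕ → Set
    RankedNeighbour v N c = Σ ℕ λ e → e < N × adj G v (Q e) ≡ true × deg v (seg 0 e) ≡ c

    neighbour-of-rank : ∀ v N c → c < deg v (seg 0 N) → RankedNeighbour v N c
    neighbour-of-rank v zero c ()
    neighbour-of-rank v (suc N) c c<deg with c <? deg v (seg 0 N) | deg-prefix-suc v N
    ... | yes c<deg′ | _ = let (e , e<N , ve , rank) = neighbour-of-rank v N c c<deg′ in e , m<n⇒m<1+n e<N , ve , rank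
    ... | no c≮deg′ | step with adj G v (Q N) in vN
    ...   | true = N , ≤-refl , vN , ≤-antisym (≮⇒≥ c≮deg′) (s≤s⁻¹ (≤-trans c<deg (≤-reflexive (trans step (+-comm _ 1)))))
    ...   | false = ⊥-elim (c≮deg′ (≤-trans c<deg (≤-reflexive (trans step (+-identityʳ _)))))

    chord-fan : ∀ {u} k e d → (∀ j → j < m → Q j ≢ u) → adj G u (Q e) ≡ true → adj G u (Q (e + suc d)) ≡ true →
      e + suc d + 2 ≤ m → deg u (seg e (suc (suc d))) ≡ k + 2 → HasCycleWithExactlyChords G k
    chord-fan {u} k e d u∉path u~Qe u~Qe′ e′+2≤m deg≡k+2 =
      closedWalk⇒HasCycleWithExactlyChords k u L walk closing unique 2≤length edges≡
      where
      L = seg e (suc (suc d))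
      e+d+2≤m : e + suc (suc d) ≤ m
      e+d+2≤m = ≤-trans (≤-reflexive (trans (+-suc e (suc d)) (+-comm 1 (e + suc d))))
                        (≤-trans (+-monoʳ-≤ (e + suc d) (n≤1+n 1)) e′+2≤m)
      walk : Walk u L
      walk = subst T (sym u~Qe) tt , walk-seg e (suc d) (subst (_≤ m) (+-suc e (suc d)) e+d+2≤m)
      closing : E G (lastOr u L) u
      closing = subst (λ z → E G z u) (sym (lastOr-seg e (suc d))) (E-sym (subst T (sym u~Qe′) tt))
      unique : Unique (u ∷ L)
      unique = all-seg e (suc (suc d)) (λ j _ j< u≡Qj → u∉path j (<-≤-trans j< e+d+2≤m) (sym u≡Qj)) ∷
               unique-seg e (suc (suc d)) e+d+2≤m
      2≤length : 2 ≤ length L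
      2≤length = ≤-trans (s≤s (s≤s z≤n)) (≤-reflexive (sym (length-seg e (suc (suc d)))))
      edges≡ : edges (u ∷ L) ≡ k + length (u ∷ L)
      edges≡ = begin
        deg u L + edges L      ≡⟨ cong₂ _+_ deg≡k+2 (edges-seg e (suc d) e′+2≤m) ⟩
        k + 2 + suc d          ≡⟨ rearrange k d ⟩
        k + suc (suc (suc d))  ≡⟨ cong (λ z → k + suc z) (sym (length-seg e (suc (suc d)))) ⟩
        k + length (u ∷ L)     ∎
        where
        open ≡-Reasoning
        rearrange : ∀ k d → k + 2 + suc d ≡ k + suc (suc (suc d))
        rearrange = solve-∀

    fan : ∀ {u} k → (∀ j → j < m → Q j ≢ u) → k + 3 ≤ deg u (seg 0 m) → HasCycleWithExactlyChords G k
    fan {u} k u∉path k+3≤deg =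
      between (neighbour-of-rank u m₁ 0 (≤-trans (s≤s z≤n) (≤-trans (m≤n+m 2 k) k+2≤deg₁)))
              (neighbour-of-rank u m₁ (suc k) (≤-trans (≤-reflexive (+-comm 2 k)) k+2≤deg₁))
      where
      m₁ = m ∸ 1
      m₁+1≡m : suc m₁ ≡ m
      m₁+1≡m = trans (+-comm 1 m₁) (m∸n+n≡m (≤-trans (≤-trans (s≤s z≤n) (m≤n+m 3 k)) (≤-trans k+3≤deg (deg-prefix≤length u m))))
      k+2≤deg₁ : k + 2 ≤ deg u (seg 0 m₁)
      k+2≤deg₁ = +-cancelʳ-≤ 1 (k + 2) _ (begin
        k + 2 + 1                                  ≡⟨ +-assoc k 2 1 ⟩
        k + 3                                      ≤⟨ k+3≤deg ⟩
        deg u (seg 0 m)                            ≡⟨ cong (deg u ∘ seg 0) m₁+1≡m ⟨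
        deg u (seg 0 (suc m₁))                     ≡⟨ deg-prefix-suc u m₁ ⟩
        deg u (seg 0 m₁) + b2n (adj G u (Q m₁))    ≤⟨ +-monoʳ-≤ _ (b2n≤1 _) ⟩
        deg u (seg 0 m₁) + 1                       ∎)
        where open ≤-Reasoning
      between : RankedNeighbour u m₁ 0 → RankedNeighbour u m₁ (suc k) → HasCycleWithExactlyChords G k
      between (e₁ , _ , u~Qe₁ , rank₁) (e₂ , e₂<m₁ , u~Qe₂ , rank₂) =
        chord-fan k e₁ d u∉path u~Qe₁ (subst (λ z → adj G u (Q z) ≡ true) (sym e₁+1+d≡e₂) u~Qe₂) e₂+2≤m deg-between
        where
        e₁<e₂ : e₁ < e₂
        e₁<e₂ = ≰⇒> λ e₂≤e₁ → 1+n≢0 (n≤0⇒n≡0 (subst₂ _≤_ rank₂ rank₁ (deg-prefix-mono u e₂≤e₁)))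
        d = e₂ ∸ suc e₁
        e₁+1+d≡e₂ : e₁ + suc d ≡ e₂
        e₁+1+d≡e₂ = trans (+-suc e₁ d) (trans (+-comm (suc e₁) d) (m∸n+n≡m e₁<e₂))
        e₂+2≤m : e₁ + suc d + 2 ≤ m
        e₂+2≤m = ≤-trans (≤-reflexive (trans (cong (_+ 2) e₁+1+d≡e₂) (+-comm e₂ 2))) (≤-trans (s≤s e₂<m₁) (≤-reflexive m₁+1≡m))
        deg-between : deg u (seg e₁ (suc (suc d))) ≡ k + 2
        deg-between = +-cancelˡ-≡ (deg u (seg 0 e₁)) _ _ (begin
          deg u (seg 0 e₁) + deg u (seg e₁ (suc (suc d)))   ≡⟨ deg-seg-++ u 0 e₁ (suc (suc d)) ⟨
          deg u (seg 0 (e₁ + suc (suc d)))                  ≡⟨ cong (deg u ∘ seg 0) (trans (+-suc e₁ (suc d)) (cong suc e₁+1+d≡e₂)) ⟩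
          deg u (seg 0 (suc e₂))                            ≡⟨ deg-prefix-suc u e₂ ⟩
          deg u (seg 0 e₂) + b2n (adj G u (Q e₂))           ≡⟨ cong₂ (λ a b → a + b2n b) rank₂ u~Qe₂ ⟩
          suc k + 1                                         ≡⟨ cong₂ _+_ (sym rank₁) (sym (+-suc k 1)) ⟩
          deg u (seg 0 e₁) + (k + 2)                        ∎)
          where open ≡-Reasoning

  module _ {S₁ : VSet G} {m : ℕ} (path : UnimodalPath S₁ m) where
    open UnimodalPath path

    private
      mirror : ∀ {j} → j < m → (m ∸ suc j) + suc j ≡ m
      mirror = m∸n+n≡m

      mirror-< : ∀ {j} → j < m → m ∸ suc j < m
      mirror-< {j} j<m = ≤-trans (≤-trans (s≤s (m≤m+n (m ∸ suc j) j)) (≤-reflexive (sym (+-suc _ j)))) (≤-reflexive (mirror j<m))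

      mirror-≤ : ∀ {a b c} → a + b ≡ m → c + b ≤ m → c ≤ a
      mirror-≤ {a} {b} {c} a+b≡m c+b≤m = +-cancelʳ-≤ b c a (≤-trans c+b≤m (≤-reflexive (sym a+b≡m)))

      Q′ : ℕ → V
      Q′ j = Q (m ∸ suc j)
      adjacent′ : ∀ j → suc j < m → E G (Q′ j) (Q′ (suc j))
      adjacent′ j j+1<m =
        subst (λ z → E G (Q z) (Q a)) (sym a+1≡) (E-sym (adjacent a (subst (_< m) a+1≡ (mirror-< (<-trans (n<1+n j) j+1<m)))))
        where
        a = m ∸ suc (suc j)
        a+1≡ : m ∸ suc j ≡ suc a
        a+1≡ = +-cancelʳ-≡ (suc j) _ _ (trans (mirror (<-trans (n<1+n j) j+1<m)) (trans (sym (mirror j+1<m)) (+-suc a (suc j))))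
      induced′ : ∀ i j → 2 + i ≤ j → j < m → E G (Q′ i) (Q′ j) → i ≡ 0 × suc j ≡ m
      induced′ i j 2+i≤j j<m Q′i~Q′j =
        suc-injective (+-cancelˡ-≡ i* _ _ (trans (mirror i<m) (trans (sym (proj₂ ends)) (+-comm 1 i*)))) ,
        trans (cong (_+ suc j) (sym (proj₁ ends))) (mirror j<m)
        where
        i<m = <-trans (≤-trans (n≤1+n _) 2+i≤j) j<m
        i* = m ∸ suc i
        j* = m ∸ suc j
        2+j*≤i* : 2 + j* ≤ i*
        2+j*≤i* = mirror-≤ (mirror i<m)
          (≤-trans (≤-reflexive (shift j* i)) (≤-trans (+-monoʳ-≤ j* (s≤s 2+i≤j)) (≤-reflexive (mirror j<m))))
          where
          shift : ∀ a b → 2 + a + suc b ≡ a + suc (2 + b)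
          shift = solve-∀
        ends = induced j* i* 2+j*≤i* (mirror-< i<m) (E-sym Q′i~Q′j)
      injective′ : ∀ i j → i < m → j < m → Q′ i ≡ Q′ j → i ≡ j
      injective′ i j i<m j<m Q′i≡Q′j = suc-injective (+-cancelˡ-≡ (m ∸ suc i) _ _ (trans (mirror i<m)
        (trans (sym (mirror j<m)) (cong (_+ suc j) (sym (injective _ _ (mirror-< i<m) (mirror-< j<m) Q′i≡Q′j))))))
      middle-avoids-S₁′ : ∀ j v → 2 ≤ j → j + 3 ≤ m → T (S₁ v) → ¬ E G (Q′ j) v
      middle-avoids-S₁′ j v 2≤j j+3≤m = middle-avoids-S₁ (m ∸ suc j) v
        (mirror-≤ (mirror j<m) (≤-trans (≤-reflexive (shift j)) j+3≤m))
        (≤-trans (+-monoʳ-≤ (m ∸ suc j) (s≤s 2≤j)) (≤-reflexive (mirror j<m)))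
        where
        j<m = ≤-trans (s≤s (m≤m+n j 2)) (≤-trans (≤-reflexive (sym (+-suc j 2))) j+3≤m)
        shift : ∀ j → 2 + suc j ≡ j + 3
        shift = solve-∀
      interior-outside-S₁′ : ∀ j → 0 < j → suc j < m → ¬ T (S₁ (Q′ j))
      interior-outside-S₁′ j 0<j j+1<m = interior-outside-S₁ (m ∸ suc j)
        (mirror-≤ (mirror j<m) j+1<m)
        (≤-trans (≤-reflexive (+-comm 2 (m ∸ suc j))) (≤-trans (+-monoʳ-≤ (m ∸ suc j) (s≤s 0<j)) (≤-reflexive (mirror j<m))))
        where
        j<m = <-trans (n<1+n j) j+1<m

    reversePath : UnimodalPath S₁ m
    reversePath = record
      { Q = Q′
      ; adjacent = adjacent′
      ; induced = induced′
      ; injective = injective′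
      ; middle-avoids-S₁ = middle-avoids-S₁′
      ; interior-outside-S₁ = interior-outside-S₁′
      }

    reversePath-avoids : ∀ {v} → (∀ j → j < m → Q j ≢ v) → ∀ j → j < m → UnimodalPath.Q reversePath j ≢ v
    reversePath-avoids v∉path j j<m = v∉path (m ∸ suc j) (mirror-< j<m)

    deg-reversePath : ∀ v → deg v (UnimodalPath.seg reversePath 0 m) ≡ deg v (seg 0 m)
    deg-reversePath v = begin
      count (map (adj G v) (map (λ j → Q (m ∸ suc j)) (range 0 m)))
        ≡⟨ cong (count ∘ map (adj G v)) (map-∘ (range 0 m)) ⟩
      count (map (adj G v) (map Q (map (λ j → m ∸ suc j) (range 0 m))))
        ≡⟨ cong (count ∘ map (adj G v) ∘ map Q) (map-reflect-range m) ⟩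
      count (map (adj G v) (map Q (reverse (range 0 m))))
        ≡⟨ cong (count ∘ map (adj G v)) (reverse-map Q (range 0 m)) ⟩
      count (map (adj G v) (reverse (seg 0 m)))
        ≡⟨ cong count (reverse-map (adj G v) (seg 0 m)) ⟩
      count (reverse (map (adj G v) (seg 0 m)))
        ≡⟨ count-reverse (map (adj G v) (seg 0 m)) ⟩
      deg v (seg 0 m) ∎
      where open ≡-Reasoning

  module IndexedPath {S₀ S₁ : VSet G} {x y : V} {m : ℕ} {P : Fin m → V} (unimodal : IsUnimodal G S₀ S₁ x y m P) where

    private
      Q : ℕ → V
      Q = atℕ m P x

      P-path : IsPathInducedExceptEnds G S₀ x y m P
      P-path = let (_ , _ , _ , P-path , _ , _) = unimodal in P-path

      P-injective : ∀ {i j} → P i ≡ P j → i ≡ j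
      P-injective = let (P-inj , _ , _ , _ , _ , _) = P-path in P-inj

      P-adjacent : ∀ i j → toℕ j ≡ suc (toℕ i) → E G (P i) (P j)
      P-adjacent = let (_ , _ , _ , _ , P-adj , _) = P-path in P-adj

      P-induced : ∀ i j → suc (suc (toℕ i)) ≤ toℕ j → E G (P i) (P j) → toℕ i ≡ 0 × suc (toℕ j) ≡ m
      P-induced = let (_ , _ , _ , _ , _ , P-ind) = P-path in P-ind

      P-interior : ∀ i → 0 < toℕ i → suc (toℕ i) < m → ¬ T (S₁ (P i))
      P-interior = let (_ , _ , _ , _ , P-int , _) = unimodal in P-int

      P-middle-avoids-S₁ : ∀ i v → 2 ≤ toℕ i → toℕ i + 3 ≤ m → T (S₁ v) → ¬ E G (P i) v
      P-middle-avoids-S₁ = let (_ , _ , _ , _ , _ , P-mid) = unimodal in P-mid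

      adjacent : ∀ j → suc j < m → E G (Q j) (Q (suc j))
      adjacent j j+1<m = subst₂ (E G) (sym (atℕ-< P x j j<m)) (sym (atℕ-< P x (suc j) j+1<m))
        (P-adjacent (fromℕ< j<m) (fromℕ< j+1<m) (trans (toℕ-fromℕ< j+1<m) (cong suc (sym (toℕ-fromℕ< j<m)))))
        where
        j<m = <-trans (n<1+n j) j+1<m
      induced : ∀ i j → 2 + i ≤ j → j < m → E G (Q i) (Q j) → i ≡ 0 × suc j ≡ m
      induced i j 2+i≤j j<m Qi~Qj =
        let (i≡0 , j+1≡m) = P-induced (fromℕ< i<m) (fromℕ< j<m)
                              (subst₂ (λ a b → suc (suc a) ≤ b) (sym (toℕ-fromℕ< i<m)) (sym (toℕ-fromℕ< j<m)) 2+i≤j)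
                              (subst₂ (E G) (atℕ-< P x i i<m) (atℕ-< P x j j<m) Qi~Qj)
        in trans (sym (toℕ-fromℕ< i<m)) i≡0 , trans (cong suc (sym (toℕ-fromℕ< j<m))) j+1≡m
        where
        i<m = <-trans (≤-trans (n≤1+n _) 2+i≤j) j<m
      injective : ∀ i j → i < m → j < m → Q i ≡ Q j → i ≡ j
      injective i j i<m j<m Qi≡Qj = trans (sym (toℕ-fromℕ< i<m))
        (trans (cong toℕ (P-injective (trans (sym (atℕ-< P x i i<m)) (trans Qi≡Qj (atℕ-< P x j j<m))))) (toℕ-fromℕ< j<m))
      middle-avoids-S₁ : ∀ j v → 2 ≤ j → j + 3 ≤ m → T (S₁ v) → ¬ E G (Q j) v
      middle-avoids-S₁ j v 2≤j j+3≤m v∈S₁ = subst (λ z → ¬ E G z v) (sym (atℕ-< P x j j<m))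
        (P-middle-avoids-S₁ (fromℕ< j<m) v (subst (2 ≤_) (sym (toℕ-fromℕ< j<m)) 2≤j)
                                           (subst (λ z → z + 3 ≤ m) (sym (toℕ-fromℕ< j<m)) j+3≤m) v∈S₁)
        where
        j<m = ≤-trans (s≤s (m≤m+n j 2)) (≤-trans (≤-reflexive (sym (+-suc j 2))) j+3≤m)
      interior-outside-S₁ : ∀ j → 0 < j → suc j < m → ¬ T (S₁ (Q j))
      interior-outside-S₁ j 0<j j+1<m = subst (λ z → ¬ T (S₁ z)) (sym (atℕ-< P x j j<m))
        (P-interior (fromℕ< j<m) (subst (0 <_) (sym (toℕ-fromℕ< j<m)) 0<j) (subst (λ z → suc z < m) (sym (toℕ-fromℕ< j<m)) j+1<m))
        where
        j<m = <-trans (n<1+n j) j+1<m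

    indexedPath : UnimodalPath S₁ m
    indexedPath = record
      { Q = Q
      ; adjacent = adjacent
      ; induced = induced
      ; injective = injective
      ; middle-avoids-S₁ = middle-avoids-S₁
      ; interior-outside-S₁ = interior-outside-S₁
      }

    indexedPath-start : 0 < m → atℕ m P x 0 ≡ x
    indexedPath-start 0<m = trans (atℕ-< P x 0 0<m) (let (_ , P-start , _) = P-path in P-start (fromℕ< 0<m) (toℕ-fromℕ< 0<m))

    indexedPath-end : 0 < m → atℕ m P x (m ∸ 1) ≡ y
    indexedPath-end (s≤s z≤n) =
      trans (atℕ-< P x (m ∸ 1) ≤-refl) (let (_ , _ , P-end , _) = P-path in P-end (fromℕ< ≤-refl) (cong suc (toℕ-fromℕ< ≤-refl)))

    indexedPath-avoids : ∀ {v} → (∀ j → P j ≢ v) → ∀ j → j < m → atℕ m P x j ≢ v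
    indexedPath-avoids P∌v j j<m = subst (_≢ _) (sym (atℕ-< P x j j<m)) (P∌v (fromℕ< j<m))

    deg-indexedPath : ∀ v → deg v (UnimodalPath.seg indexedPath 0 m) ≡ neighboursOnPath G v m P
    deg-indexedPath v = cong count (begin
      map (adj G v) (map Q (range 0 m))                ≡⟨ map-∘ (range 0 m) ⟨
      map (adj G v ∘ Q) (range 0 m)                    ≡⟨ cong (map (adj G v ∘ Q)) (map-toℕ-allFin m) ⟨
      map (adj G v ∘ Q) (map toℕ (allFin m))           ≡⟨ map-∘ (allFin m) ⟨
      map (adj G v ∘ Q ∘ toℕ) (allFin m)               ≡⟨ map-cong (cong (adj G v) ∘ atℕ-toℕ P x) (allFin m) ⟩
      map (λ i → adj G v (P i)) (allFin m)             ∎)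
      where open ≡-Reasoning

  -- Alternating paths in K_{ℓ,ℓ}

  swap-Kll : ∀ {S ℓ a b} → IsInducedKll G S ℓ a b → IsInducedKll G S ℓ b a
  swap-Kll (a-inj , b-inj , a≢b , a∈S , b∈S , a~b , a≁a , b≁b) =
    b-inj , a-inj , (λ i j → a≢b j i ∘ sym) , b∈S , a∈S , (λ i j → E-sym (a~b j i)) , b≁b , a≁a

  swap-InK : ∀ {ℓ} {a b : Fin ℓ → V} {v} → InK {G} a b v → InK {G} b a v
  swap-InK (inj₁ x) = inj₂ x
  swap-InK (inj₂ y) = inj₁ y

  IsInducedKll-mono : ∀ {S S′ ℓ a b} → (∀ v → T (S v) → T (S′ v)) → IsInducedKll G S ℓ a b → IsInducedKll G S′ ℓ a b
  IsInducedKll-mono S⊆S′ (a-inj , b-inj , a≢b , a∈S , b∈S , a~b , a≁a , b≁b) =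
    a-inj , b-inj , a≢b , (λ i → S⊆S′ _ (a∈S i)) , (λ j → S⊆S′ _ (b∈S j)) , a~b , a≁a , b≁b

  module AlternatingPaths {S₁ : VSet G} {ℓ : ℕ} {A B : Fin ℓ → V} (K : IsInducedKll G S₁ ℓ A B) where

    A-injective : ∀ {i j} → A i ≡ A j → i ≡ j
    A-injective = let (a-inj , _ , _ , _ , _ , _ , _ , _) = K in a-inj

    B-injective : ∀ {i j} → B i ≡ B j → i ≡ j
    B-injective = let (_ , b-inj , _ , _ , _ , _ , _ , _) = K in b-inj

    A≢B : ∀ i j → A i ≢ B j
    A≢B = let (_ , _ , a≢b , _ , _ , _ , _ , _) = K in a≢b

    A~B : ∀ i j → E G (A i) (B j)
    A~B = let (_ , _ , _ , _ , _ , a~b , _ , _) = K in a~b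

    InK⇒S₁ : ∀ {v} → InK {G} A B v → T (S₁ v)
    InK⇒S₁ (inj₁ (i , refl)) = let (_ , _ , _ , a∈S , _ , _ , _ , _) = K in a∈S i
    InK⇒S₁ (inj₂ (j , refl)) = let (_ , _ , _ , _ , b∈S , _ , _ , _) = K in b∈S j

    deg-edge : ∀ {v} → InK {G} A B v → ∀ i j → deg v (A i ∷ B j ∷ []) ≡ 1
    deg-edge (inj₁ (i′ , refl)) i j
      rewrite ¬T⇒≡false (let (_ , _ , _ , _ , _ , _ , a≁a , _) = K in a≁a i′ i) | T⇒≡true (A~B i′ j) = refl
    deg-edge (inj₂ (j′ , refl)) i j
      rewrite ¬T⇒≡false (let (_ , _ , _ , _ , _ , _ , _ , b≁b) = K in b≁b j′ j) | T⇒≡true (E-sym (A~B i j′)) = refl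

    module _ (α β : ℕ → Fin ℓ) where

      alternating : ℕ → List V
      alternating zero = []
      alternating (suc t) = alternating t ++ A (α t) ∷ B (β t) ∷ []

      length-alternating : ∀ t → length (alternating t) ≡ 2 * t
      length-alternating zero = refl
      length-alternating (suc t) = trans (length-++ (alternating t)) (trans (cong (_+ 2) (length-alternating t)) (step t))
        where
        step : ∀ t → 2 * t + 2 ≡ 2 * suc t
        step = solve-∀

      deg-alternating : ∀ {v} → InK {G} A B v → ∀ t → deg v (alternating t) ≡ t
      deg-alternating v∈K zero = refl
      deg-alternating {v} v∈K (suc t) =
        trans (deg-++ v (alternating t) _) (trans (cong₂ _+_ (deg-alternating v∈K t) (deg-edge v∈K (α t) (β t))) (+-comm t 1))

      edges-alternating : ∀ t → edges (alternating t) ≡ t * t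
      edges-alternating zero = refl
      edges-alternating (suc t) = begin
        edges (alternating t ++ A (α t) ∷ B (β t) ∷ [])
          ≡⟨ edges-++ (alternating t) (A (α t) ∷ B (β t) ∷ []) ⟩
        edges (alternating t) + edges (A (α t) ∷ B (β t) ∷ []) + cross (alternating t) (A (α t) ∷ B (β t) ∷ [])
          ≡⟨ cong₂ (λ x y → x + edges (A (α t) ∷ B (β t) ∷ []) + y) (edges-alternating t) cross-last ⟩
        t * t + edges (A (α t) ∷ B (β t) ∷ []) + (t + (t + 0))
          ≡⟨ cong (λ z → t * t + z + (t + (t + 0))) last-edge ⟩
        t * t + 1 + (t + (t + 0))
          ≡⟨ square t ⟩
        suc t * suc t ∎
        where
        open ≡-Reasoning
        last-edge : edges (A (α t) ∷ B (β t) ∷ []) ≡ 1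
        last-edge rewrite T⇒≡true (A~B (α t) (β t)) = refl
        cross-last : cross (alternating t) (A (α t) ∷ B (β t) ∷ []) ≡ t + (t + 0)
        cross-last =
          trans (cross-∷ʳ (alternating t) (A (α t)) (B (β t) ∷ []))
                (cong₂ _+_ (deg-alternating (inj₁ (α t , refl)) t)
                           (trans (cross-∷ʳ (alternating t) (B (β t)) [])
                                  (cong₂ _+_ (deg-alternating (inj₂ (β t , refl)) t) (cross-[] (alternating t)))))
        square : ∀ t → t * t + 1 + (t + (t + 0)) ≡ suc t * suc t
        square = solve-∀

      walk-alternating : ∀ t {z} → (Σ (Fin ℓ) λ j → z ≡ B j) →
        Walk z (alternating t) × (Σ (Fin ℓ) λ j → lastOr z (alternating t) ≡ B j)
      walk-alternating zero z∈B = tt , z∈B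
      walk-alternating (suc t) {z} z∈B with walk-alternating t z∈B
      ... | walk , (j , end≡Bj) =
        walk-++ z (alternating t) _ walk (subst (λ y → E G y (A (α t))) (sym end≡Bj) (E-sym (A~B (α t) j)) , A~B (α t) (β t) , tt) ,
        (β t , lastOr-++ z (alternating t) _)

      UsedBefore : ℕ → V → Set
      UsedBefore t v = Σ ℕ λ s → s < t × (v ≡ A (α s) ⊎ v ≡ B (β s))

      alternating-used : ∀ t → All (UsedBefore t) (alternating t)
      alternating-used zero = []
      alternating-used (suc t) =
        All.++⁺ (All.map (λ (s , s<t , v≡) → s , m<n⇒m<1+n s<t , v≡) (alternating-used t))
                ((t , ≤-refl , inj₁ refl) ∷ (t , ≤-refl , inj₂ refl) ∷ [])

      unique-alternating : ∀ k → (∀ s t → s < k → t < k → α s ≡ α t → s ≡ t) → (∀ s t → s < k → t < k → β s ≡ β t → s ≡ t) →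
        ∀ t → t ≤ k → Unique (alternating t)
      unique-alternating k α-inj β-inj zero _ = []
      unique-alternating k α-inj β-inj (suc t) t<k =
        AllPairs.++⁺ (unique-alternating k α-inj β-inj t (<⇒≤ t<k)) ((A≢B (α t) (β t) ∷ []) ∷ [] ∷ [])
                     (All.map fresh (alternating-used t))
        where
        fresh : ∀ {v} → UsedBefore t v → All (v ≢_) (A (α t) ∷ B (β t) ∷ [])
        fresh (s , s<t , inj₁ refl) = (λ e → <⇒≢ s<t (α-inj s t (<-trans s<t t<k) t<k (A-injective e))) ∷ A≢B (α s) (β t) ∷ []
        fresh (s , s<t , inj₂ refl) =
          (λ e → A≢B (α t) (β s) (sym e)) ∷ (λ e → <⇒≢ s<t (β-inj s t (<-trans s<t t<k) t<k (B-injective e))) ∷ []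

  -- The cycle through u, K_{ℓ,ℓ} and the path

  -- prefix is [] when w lies on side B, and a single fresh B-vertex when w lies on side A like Q 0;
  -- either way the walk w, prefix, alternating t ends on side B and so is adjacent to Q 0.
  module AlternatingCycle
    {S₁ : VSet G} {ℓ : ℕ} {A B : Fin ℓ → V} (K : IsInducedKll G S₁ ℓ A B)
    {m : ℕ} (path : UnimodalPath S₁ m)
    {u w : V} (u~w : E G u w) (w∈K : InK {G} A B w)
    (u∉path : ∀ j → j < m → UnimodalPath.Q path j ≢ u) (w∉path : ∀ j → j < m → UnimodalPath.Q path j ≢ w)
    (i₀ : Fin ℓ) (Q0≡A : UnimodalPath.Q path 0 ≡ A i₀)
    (k : ℕ) (α β : ℕ → Fin ℓ)
    (α-injective : ∀ s t → s < k → t < k → α s ≡ α t → s ≡ t)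
    (β-injective : ∀ s t → s < k → t < k → β s ≡ β t → s ≡ t)
    (α-fresh : ∀ s → s < k → (A (α s) ≢ UnimodalPath.Q path 0) × (A (α s) ≢ u) × (A (α s) ≢ w))
    (β-fresh : ∀ s → s < k → (B (β s) ≢ u) × (B (β s) ≢ w))
    (prefix : List V) (prefix∈K : All (InK {G} A B) prefix)
    (prefix-fresh : All (λ v → (v ≢ UnimodalPath.Q path 0) × (v ≢ u) × (v ≢ w)) prefix)
    (prefix-unique : Unique prefix)
    (prefix-disjoint : All (λ v → ∀ s → s < k → (v ≢ A (α s)) × (v ≢ B (β s))) prefix)
    (prefix-walk : Walk w prefix) (prefix-end : Σ (Fin ℓ) λ j → lastOr w prefix ≡ B j)
    (prefix-edges : b2n (adj G w (UnimodalPath.Q path 0)) + deg w prefix + edges prefix + deg (UnimodalPath.Q path 0) prefix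
                    ≡ length prefix + 1)
    (prefix-short : length prefix ≤ 1)
    where

    open UnimodalPath path
    open UnimodalPathProperties path
    open AlternatingPaths {S₁ = S₁} {A = A} {B = B} K

    kWalk : ℕ → List V
    kWalk t = prefix ++ alternating α β t

    Fresh : V → Set
    Fresh v = InK {G} A B v × (v ≢ Q 0) × (v ≢ u) × (v ≢ w)

    kWalk-fresh : ∀ t → t ≤ k → All Fresh (kWalk t)
    kWalk-fresh t t≤k = All.++⁺ (All.zip (prefix∈K , prefix-fresh))
                                (All.map fresh (alternating-used α β t))
      where
      fresh : ∀ {v} → UsedBefore α β t v → Fresh v
      fresh (s , s<t , inj₁ refl) = inj₁ (α s , refl) , α-fresh s (<-≤-trans s<t t≤k)
      fresh (s , s<t , inj₂ refl) =
        inj₂ (β s , refl) , (λ e → A≢B i₀ (β s) (trans (sym Q0≡A) (sym e))) , β-fresh s (<-≤-trans s<t t≤k)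

    kWalk-unique : ∀ t → t ≤ k → Unique (kWalk t)
    kWalk-unique t t≤k =
      AllPairs.++⁺ prefix-unique (unique-alternating α β k α-injective β-injective t t≤k)
                   (All.map (λ v∉ → All.map (avoid v∉) (alternating-used α β t)) prefix-disjoint)
      where
      avoid : ∀ {v z} → (∀ s → s < k → (v ≢ A (α s)) × (v ≢ B (β s))) → UsedBefore α β t z → v ≢ z
      avoid v∉ (s , s<t , inj₁ refl) = proj₁ (v∉ s (<-≤-trans s<t t≤k))
      avoid v∉ (s , s<t , inj₂ refl) = proj₂ (v∉ s (<-≤-trans s<t t≤k))

    -- By edges-cycle, the cycle of cycle-through has exactly c + Z t chords, where c counts the
    -- neighbours of u on the path before the vertex where the cycle returns to u.
    Z : ℕ → ℕ
    Z t = deg u (kWalk t) + deg (Q 1) (kWalk t) + b2n (adj G w (Q 1)) + t * t + length prefix * t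

    deg-kWalk-suc : ∀ v t → deg v (kWalk (suc t)) ≤ deg v (kWalk t) + 2
    deg-kWalk-suc v t = begin
      deg v (prefix ++ alternating α β t ++ A (α t) ∷ B (β t) ∷ [])
        ≡⟨ cong (deg v) (++-assoc prefix (alternating α β t) _) ⟨
      deg v (kWalk t ++ A (α t) ∷ B (β t) ∷ [])
        ≡⟨ deg-++ v (kWalk t) _ ⟩
      deg v (kWalk t) + deg v (A (α t) ∷ B (β t) ∷ [])
        ≤⟨ +-monoʳ-≤ (deg v (kWalk t)) (deg≤length v (A (α t) ∷ B (β t) ∷ [])) ⟩
      deg v (kWalk t) + 2 ∎
      where open ≤-Reasoning

    Z-step : ∀ t → Z (suc t) ≤ Z t + (2 * t + 6)
    Z-step t = begin
      deg u (kWalk (suc t)) + deg (Q 1) (kWalk (suc t)) + b2n (adj G w (Q 1)) + suc t * suc t + p * suc t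
        ≤⟨ +-monoˡ-≤ (p * suc t) (+-monoˡ-≤ (suc t * suc t) (+-monoˡ-≤ (b2n (adj G w (Q 1)))
             (+-mono-≤ (deg-kWalk-suc u t) (deg-kWalk-suc (Q 1) t)))) ⟩
      (deg u (kWalk t) + 2) + (deg (Q 1) (kWalk t) + 2) + b2n (adj G w (Q 1)) + suc t * suc t + p * suc t
        ≡⟨ expand (deg u (kWalk t)) (deg (Q 1) (kWalk t)) (b2n (adj G w (Q 1))) t p ⟩
      Z t + (2 * t + 5 + p)
        ≤⟨ +-monoʳ-≤ (Z t) (+-monoʳ-≤ (2 * t + 5) prefix-short) ⟩
      Z t + (2 * t + 5 + 1)
        ≡⟨ cong (Z t +_) (+-assoc (2 * t) 5 1) ⟩
      Z t + (2 * t + 6) ∎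
      where
      open ≤-Reasoning
      p = length prefix
      expand : ∀ a b c t p → (a + 2) + (b + 2) + c + suc t * suc t + p * suc t ≡ a + b + c + t * t + p * t + (2 * t + 5 + p)
      expand = solve-∀

    Z-lower : ∀ t → t * t ≤ Z t
    Z-lower t = ≤-trans (m≤n+m (t * t) (deg u (kWalk t) + deg (Q 1) (kWalk t) + b2n (adj G w (Q 1)))) (m≤m+n _ (length prefix * t))

    Z0≤3 : Z 0 ≤ 3
    Z0≤3 = begin
      deg u (kWalk 0) + deg (Q 1) (kWalk 0) + b2n (adj G w (Q 1)) + 0 + length prefix * 0
        ≡⟨ cong (λ z → deg u (kWalk 0) + deg (Q 1) (kWalk 0) + b2n (adj G w (Q 1)) + 0 + z) (*-zeroʳ (length prefix)) ⟩
      deg u (kWalk 0) + deg (Q 1) (kWalk 0) + b2n (adj G w (Q 1)) + 0 + 0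
        ≤⟨ +-monoˡ-≤ 0 (+-monoˡ-≤ 0 (+-mono-≤ (+-mono-≤ (short u) (short (Q 1))) (b2n≤1 (adj G w (Q 1))))) ⟩
      3 ∎
      where
      open ≤-Reasoning
      short : ∀ v → deg v (kWalk 0) ≤ 1
      short v = ≤-trans (deg≤length v (kWalk 0)) (≤-trans (≤-reflexive (cong length (++-identityʳ prefix))) prefix-short)

    module _ (t : ℕ) (t≤k : t ≤ k) (e′ : ℕ) (e+3≤m : suc e′ + 3 ≤ m) where

      private
        e = suc e′
        Kt = kWalk t
        X = seg 0 (suc e)
        p = length prefix

        e<m : e < m
        e<m = ≤-trans (s≤s (m≤m+n e 2)) (≤-trans (≤-reflexive (sym (+-suc e 2))) e+3≤m)

        Kt-walk = walk-alternating α β t prefix-end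
        j-end = proj₁ (proj₂ Kt-walk)

        Kt-end : lastOr w Kt ≡ B j-end
        Kt-end = trans (lastOr-++ w prefix (alternating α β t)) (proj₂ (proj₂ Kt-walk))

        Kt-fresh = kWalk-fresh t t≤k

        off-path : ∀ v → Fresh v → All (v ≢_) X
        off-path v (v∈K , v≢Q0 , _ , _) = all-seg 0 (suc e) λ where
          zero _ _ → v≢Q0
          (suc j) _ j<e+1 v≡Qj → interior-outside-S₁ (suc j) z<s
                                   (<-≤-trans (s≤s j<e+1) (≤-trans (m≤n+m (suc (suc e)) 1) (≤-trans (≤-reflexive (+-comm 3 e)) e+3≤m)))
                                   (subst (T ∘ S₁) v≡Qj (InK⇒S₁ v∈K))

        deg-middle≡0 : ∀ v → T (S₁ v) → deg v (seg 2 e′) ≡ 0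
        deg-middle≡0 v v∈S₁ = trans (deg-seg v 2 e′) (count-map-false (all-range 2 e′ λ j 2≤j j<2+e′ →
          ¬T⇒≡false (middle-avoids-S₁ j v 2≤j (≤-trans (+-monoˡ-≤ 3 (s≤s⁻¹ j<2+e′)) e+3≤m) v∈S₁ ∘ E-sym)))

      cycleTail : List V
      cycleTail = w ∷ Kt ++ X

      walk-cycleTail : Walk u cycleTail
      walk-cycleTail =
        u~w , walk-++ w Kt X (walk-++ w prefix _ prefix-walk (proj₁ Kt-walk))
                (subst (λ y → Walk y X) (sym Kt-end) (subst (E G (B j-end)) (sym Q0≡A) (E-sym (A~B i₀ j-end)) , walk-seg 0 e e<m))

      lastOr-cycleTail : lastOr u cycleTail ≡ Q e
      lastOr-cycleTail = trans (lastOr-++ w Kt X) (trans (cong (λ y → lastOr y X) Kt-end) (lastOr-seg 0 e))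

      unique-cycle : Unique (u ∷ cycleTail)
      unique-cycle =
        (u≢w ∷ All.++⁺ (All.map (λ (_ , _ , v≢u , _) → v≢u ∘ sym) Kt-fresh)
                       (all-seg 0 (suc e) (λ j _ j<e+1 → u∉path j (≤-trans j<e+1 e<m) ∘ sym))) ∷
        All.++⁺ (All.map (λ (_ , _ , _ , v≢w) → v≢w ∘ sym) Kt-fresh)
                (all-seg 0 (suc e) (λ j _ j<e+1 → w∉path j (≤-trans j<e+1 e<m) ∘ sym)) ∷
        AllPairs.++⁺ (kWalk-unique t t≤k) (unique-seg 0 (suc e) e<m) (All.map (λ {v} → off-path v) Kt-fresh)
        where
        u≢w : u ≢ w
        u≢w refl = subst T (irrefl G u) u~w

      length-cycleTail : length cycleTail ≡ suc ((p + 2 * t) + (2 + e′))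
      length-cycleTail = cong suc (trans (length-++ Kt)
        (cong₂ _+_ (trans (length-++ prefix) (cong (p +_) (length-alternating α β t))) (cong (2 +_) (length-seg 2 e′))))

      deg-u-cycleTail : adj G u (Q e) ≡ true → deg u cycleTail ≡ 1 + (deg u Kt + (deg u (seg 0 e) + 1))
      deg-u-cycleTail u~Qe = begin
        deg u (w ∷ Kt ++ X)                      ≡⟨ deg-∷ u w (Kt ++ X) ⟩
        b2n (adj G u w) + deg u (Kt ++ X)        ≡⟨ cong₂ (λ b z → b2n b + z) (T⇒≡true u~w) (deg-++ u Kt X) ⟩
        1 + (deg u Kt + deg u X)                 ≡⟨ cong (λ z → 1 + (deg u Kt + z)) (deg-prefix-suc u e) ⟩
        1 + (deg u Kt + (deg u (seg 0 e) + b2n (adj G u (Q e))))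
                                                 ≡⟨ cong (λ b → 1 + (deg u Kt + (deg u (seg 0 e) + b2n b))) u~Qe ⟩
        1 + (deg u Kt + (deg u (seg 0 e) + 1))   ∎
        where open ≡-Reasoning

      deg-w-rest : deg w (Kt ++ X) ≡ (deg w prefix + t) + (b2n (adj G w (Q 0)) + (b2n (adj G w (Q 1)) + 0))
      deg-w-rest = begin
        deg w (Kt ++ X)        ≡⟨ deg-++ w Kt X ⟩
        deg w Kt + deg w X     ≡⟨ cong₂ _+_ (trans (deg-++ w prefix _) (cong (deg w prefix +_) (deg-alternating α β w∈K t)))
                                            (trans (deg-∷ w (Q 0) _) (cong (b2n (adj G w (Q 0)) +_)
                                              (trans (deg-∷ w (Q 1) _)
                                                     (cong (b2n (adj G w (Q 1)) +_) (deg-middle≡0 w (InK⇒S₁ w∈K)))))) ⟩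
        (deg w prefix + t) + (b2n (adj G w (Q 0)) + (b2n (adj G w (Q 1)) + 0)) ∎
        where open ≡-Reasoning

      edges-rest : edges (Kt ++ X) ≡ (edges prefix + t * t + p * t) + e + ((deg (Q 0) prefix + t) + (deg (Q 1) Kt + 0))
      edges-rest = begin
        edges (Kt ++ X)
          ≡⟨ edges-++ Kt X ⟩
        edges Kt + edges X + cross Kt X
          ≡⟨ cong₂ (λ a b → a + edges X + b) edges-Kt cross-Kt-X ⟩
        (edges prefix + t * t + p * t) + edges X + ((deg (Q 0) prefix + t) + (deg (Q 1) Kt + 0))
          ≡⟨ cong (λ z → (edges prefix + t * t + p * t) + z + ((deg (Q 0) prefix + t) + (deg (Q 1) Kt + 0)))
                  (edges-seg 0 e (≤-trans (+-monoʳ-≤ e (n≤1+n 2)) e+3≤m)) ⟩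
        (edges prefix + t * t + p * t) + e + ((deg (Q 0) prefix + t) + (deg (Q 1) Kt + 0)) ∎
        where
        open ≡-Reasoning
        edges-Kt : edges Kt ≡ edges prefix + t * t + p * t
        edges-Kt = trans (edges-++ prefix _)
          (cong₂ (λ a b → edges prefix + a + b) (edges-alternating α β t)
                 (cross-const prefix _ t (All.map (λ v∈K → deg-alternating α β v∈K t) prefix∈K)))
        cross-Kt-X : cross Kt X ≡ (deg (Q 0) prefix + t) + (deg (Q 1) Kt + 0)
        cross-Kt-X =
          trans (cross-∷ʳ Kt (Q 0) _)
                (cong₂ _+_ (trans (deg-++ (Q 0) prefix _) (cong (deg (Q 0) prefix +_) (deg-alternating α β (inj₁ (i₀ , Q0≡A)) t)))
                           (trans (cross-∷ʳ Kt (Q 1) _) (cong (deg (Q 1) Kt +_)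
                             (trans (cross-const Kt (seg 2 e′) 0 (All.map (λ (v∈K , _) → deg-middle≡0 _ (InK⇒S₁ v∈K)) Kt-fresh))
                                    (*-zeroʳ (length Kt))))))

      edges-cycle : adj G u (Q e) ≡ true → edges (u ∷ cycleTail) ≡ deg u (seg 0 e) + Z t + length (u ∷ cycleTail)
      edges-cycle u~Qe = begin
        deg u cycleTail + (deg w (Kt ++ X) + edges (Kt ++ X))
          ≡⟨ cong₂ _+_ (deg-u-cycleTail u~Qe) (cong₂ _+_ deg-w-rest edges-rest) ⟩
        1 + (deg u Kt + (c + 1)) + ((deg w prefix + t) + (b2n (adj G w (Q 0)) + (b2n (adj G w (Q 1)) + 0))
          + ((edges prefix + t * t + p * t) + e + ((deg (Q 0) prefix + t) + (deg (Q 1) Kt + 0))))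
          ≡⟨ regroup (deg u Kt) c (deg w prefix) t (b2n (adj G w (Q 0))) (b2n (adj G w (Q 1)))
                     (edges prefix) p e′ (deg (Q 0) prefix) (deg (Q 1) Kt) ⟩
        c + Z t + (b2n (adj G w (Q 0)) + deg w prefix + edges prefix + deg (Q 0) prefix) + (3 + 2 * t + e′)
          ≡⟨ cong (λ z → c + Z t + z + (3 + 2 * t + e′)) prefix-edges ⟩
        c + Z t + (p + 1) + (3 + 2 * t + e′)
          ≡⟨ regroup′ (c + Z t) p t e′ ⟩
        c + Z t + suc (suc ((p + 2 * t) + (2 + e′)))
          ≡⟨ cong (λ z → c + Z t + suc z) length-cycleTail ⟨
        c + Z t + length (u ∷ cycleTail) ∎
        where
        open ≡-Reasoning
        c = deg u (seg 0 e)
        regroup : ∀ a c dw t b0 b1 ep p e′ d0 d1 →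
          1 + (a + (c + 1)) + ((dw + t) + (b0 + (b1 + 0)) + ((ep + t * t + p * t) + suc e′ + ((d0 + t) + (d1 + 0))))
          ≡ c + (a + d1 + b1 + t * t + p * t) + (b0 + dw + ep + d0) + (3 + 2 * t + e′)
        regroup = solve-∀
        regroup′ : ∀ x p t e′ → x + (p + 1) + (3 + 2 * t + e′) ≡ x + suc (suc ((p + 2 * t) + (2 + e′)))
        regroup′ = solve-∀

      cycle-through : adj G u (Q e) ≡ true → deg u (seg 0 e) + Z t ≡ k → HasCycleWithExactlyChords G k
      cycle-through u~Qe c+Zt≡k =
        closedWalk⇒HasCycleWithExactlyChords k u cycleTail walk-cycleTail closing unique-cycle 2≤length
          (trans (edges-cycle u~Qe) (cong (_+ length (u ∷ cycleTail)) c+Zt≡k))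
        where
        closing : E G (lastOr u cycleTail) u
        closing = subst (λ z → E G z u) (sym lastOr-cycleTail) (E-sym (subst T (sym u~Qe) tt))
        2≤length : 2 ≤ length cycleTail
        2≤length = subst (2 ≤_) (sym length-cycleTail) (s≤s (≤-trans (s≤s z≤n) (m≤n+m (2 + e′) (p + 2 * t))))

    alternating-cycle : ∀ R → R + 3 ≡ deg u (seg 0 m) → 64 * k < (R + 3) * (R + 3) → 6 ≤ R → 4 ≤ k →
      HasCycleWithExactlyChords G k
    alternating-cycle R R+3≡deg 64k<[R+3]² 6≤R 4≤k = finish (neighbour-of-rank u (m ∸ 2) c c<deg₂)
      where
      window = slow-growth-hits-window k R Z 64k<[R+3]² 6≤R (≤-<-trans Z0≤3 4≤k) Z-lower Z-step
      t = proj₁ window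
      Zt<k = proj₁ (proj₂ window)
      c = k ∸ Z t
      2≤m : 2 ≤ m
      2≤m = ≤-trans (s≤s (s≤s z≤n)) (≤-trans (m≤n+m 3 R) (≤-trans (≤-reflexive R+3≡deg) (deg-prefix≤length u m)))
      c<deg₂ : c < deg u (seg 0 (m ∸ 2))
      c<deg₂ = +-cancelʳ-≤ 2 (suc c) _ (begin
        suc c + 2                                     ≤⟨ +-monoˡ-≤ 2 (s≤s (m≤n+o⇒m∸n≤o k (Z t) (proj₂ (proj₂ window)))) ⟩
        suc R + 2                                     ≡⟨ +-suc R 2 ⟨
        R + 3                                         ≡⟨ R+3≡deg ⟩
        deg u (seg 0 m)                               ≡⟨ cong (deg u ∘ seg 0) (m∸n+n≡m 2≤m) ⟨
        deg u (seg 0 (m ∸ 2 + 2))                     ≡⟨ deg-seg-++ u 0 (m ∸ 2) 2 ⟩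
        deg u (seg 0 (m ∸ 2)) + deg u (seg (m ∸ 2) 2) ≤⟨ +-monoʳ-≤ _ (≤-trans (deg≤length u _) (≤-reflexive (length-seg (m ∸ 2) 2))) ⟩
        deg u (seg 0 (m ∸ 2)) + 2                     ∎)
        where open ≤-Reasoning
      finish : RankedNeighbour u (m ∸ 2) c → HasCycleWithExactlyChords G k
      finish (zero , _ , _ , 0≡c) = ⊥-elim (<⇒≢ (m<n⇒0<n∸m Zt<k) 0≡c)
      finish (suc e′ , e<m-2 , u~Qe , deg≡c) =
        cycle-through t (<⇒≤ (≤-<-trans (≤-trans (n≤n*n t) (Z-lower t)) Zt<k)) e′
          (≤-trans (≤-reflexive (cong suc (+-suc e′ 2))) (≤-trans (+-monoˡ-≤ 2 e<m-2) (≤-reflexive (m∸n+n≡m 2≤m))))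
          u~Qe (trans (cong (_+ Z t) deg≡c) (m∸n+n≡m (<⇒≤ Zt<k)))

  module _ {ℓ : ℕ} (F : Fin ℓ → V) (F-injective : ∀ {i j} → F i ≡ F j → i ≡ j) where

    length-filter-avoiding : ∀ v {js} → Unique js → length js ≤ suc (length (filter (λ j → ¬? (F j ≟ᶠ v)) js))
    length-filter-avoiding v [] = z≤n
    length-filter-avoiding v {j ∷ js} (j∉js ∷ js!) with F j ≟ᶠ v
    ... | no _ = s≤s (length-filter-avoiding v js!)
    ... | yes Fj≡v = s≤s (≤-reflexive (cong length (sym (filter-all (λ i → ¬? (F i ≟ᶠ v))
                        (All.map (λ j≢i Fi≡v → j≢i (F-injective (trans Fj≡v (sym Fi≡v)))) j∉js)))))

    fresh-indices : ∀ x u w → Σ (List (Fin ℓ)) λ js → Unique js × ℓ ≤ length js + 3 ×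
                    All (λ j → (F j ≢ x) × (F j ≢ u) × (F j ≢ w)) js
    fresh-indices x u w = js₃ , unique₃ , ℓ≤ , All.zip (avoid-x , All.zip (avoid-u , avoid-w))
      where
      drop : V → List (Fin ℓ) → List (Fin ℓ)
      drop v = filter (λ j → ¬? (F j ≟ᶠ v))
      js₁ = drop x (allFin ℓ)
      js₂ = drop u js₁
      js₃ = drop w js₂
      unique₁ = Unique.filter⁺ _ (Unique.allFin⁺ ℓ)
      unique₂ = Unique.filter⁺ _ unique₁
      unique₃ = Unique.filter⁺ _ unique₂
      ℓ≤ : ℓ ≤ length js₃ + 3
      ℓ≤ = begin
        ℓ                           ≡⟨ length-tabulate (λ i → i) ⟨
        length (allFin ℓ)           ≤⟨ length-filter-avoiding x (Unique.allFin⁺ ℓ) ⟩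
        suc (length js₁)            ≤⟨ s≤s (length-filter-avoiding u unique₁) ⟩
        suc (suc (length js₂))      ≤⟨ s≤s (s≤s (length-filter-avoiding w unique₂)) ⟩
        3 + length js₃              ≡⟨ +-comm 3 (length js₃) ⟩
        length js₃ + 3              ∎
        where open ≤-Reasoning
      avoid-x = All.filter⁺ _ (All.filter⁺ _ (All.all-filter _ (allFin ℓ)))
      avoid-u = All.filter⁺ _ (All.all-filter _ js₁)
      avoid-w = All.all-filter _ js₂

    fresh-sequence : ∀ x u w k → k + 4 ≤ ℓ →
      Σ (ℕ → Fin ℓ) λ γ → (∀ s t → s ≤ k → t ≤ k → γ s ≡ γ t → s ≡ t) ×
                          (∀ s → s ≤ k → (F (γ s) ≢ x) × (F (γ s) ≢ u) × (F (γ s) ≢ w))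
    fresh-sequence x u w k k+4≤ℓ =
      nth default js , (λ s t s≤k t≤k → nth-injective default js! s t (s<js s≤k) (s<js t≤k)) ,
      (λ s s≤k → nth-All default js-fresh s (s<js s≤k))
      where
      default : Fin ℓ
      default = fromℕ< (≤-trans (s≤s z≤n) (≤-trans (m≤n+m 4 k) k+4≤ℓ))
      picked = fresh-indices x u w
      js = proj₁ picked
      js! = proj₁ (proj₂ picked)
      js-fresh = proj₂ (proj₂ (proj₂ picked))
      s<js : ∀ {s} → s ≤ k → s < length js
      s<js {s} s≤k = +-cancelʳ-≤ 3 (suc s) (length js)
        (≤-trans (+-monoˡ-≤ 3 (s≤s s≤k)) (≤-trans (≤-reflexive (sym (+-suc k 3))) (≤-trans k+4≤ℓ (proj₁ (proj₂ (proj₂ picked))))))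

  module _ {S₁ : VSet G} {ℓ : ℕ} {A B : Fin ℓ → V} (K : IsInducedKll G S₁ ℓ A B)
           {m : ℕ} (path : UnimodalPath S₁ m) where
    open UnimodalPath path
    open AlternatingPaths {S₁ = S₁} {A = A} {B = B} K

    cycle-from-A-end : ∀ {u w} → E G u w → InK {G} A B w → (∀ j → j < m → Q j ≢ u) → (∀ j → j < m → Q j ≢ w) →
      ∀ i₀ → Q 0 ≡ A i₀ → ∀ k → k + 4 ≤ ℓ → ∀ R → R + 3 ≡ deg u (seg 0 m) → 64 * k < (R + 3) * (R + 3) → 6 ≤ R → 4 ≤ k →
      HasCycleWithExactlyChords G k
    cycle-from-A-end {u} {w} u~w w∈K u∉path w∉path i₀ Q0≡A k k+4≤ℓ = with-prefix w∈K
      where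
      pick-A = fresh-sequence A A-injective (Q 0) u w k k+4≤ℓ
      pick-B = fresh-sequence B B-injective (Q 0) u w k k+4≤ℓ
      α γ β : ℕ → Fin ℓ
      α = proj₁ pick-A
      γ = proj₁ pick-B
      -- γ 0 is reserved for the prefix used when w lies on side A.
      β s = γ (suc s)
      α-injective : ∀ s t → s < k → t < k → α s ≡ α t → s ≡ t
      α-injective s t s<k t<k = proj₁ (proj₂ pick-A) s t (<⇒≤ s<k) (<⇒≤ t<k)
      β-injective : ∀ s t → s < k → t < k → β s ≡ β t → s ≡ t
      β-injective s t s<k t<k = suc-injective ∘ proj₁ (proj₂ pick-B) (suc s) (suc t) s<k t<k
      α-fresh : ∀ s → s < k → (A (α s) ≢ Q 0) × (A (α s) ≢ u) × (A (α s) ≢ w)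
      α-fresh s s<k = proj₂ (proj₂ pick-A) s (<⇒≤ s<k)
      β-fresh : ∀ s → s < k → (B (β s) ≢ u) × (B (β s) ≢ w)
      β-fresh s s<k = proj₂ (proj₂ (proj₂ pick-B) (suc s) s<k)
      open AlternatingCycle K path u~w w∈K u∉path w∉path i₀ Q0≡A k α β α-injective β-injective α-fresh β-fresh
      with-prefix : InK {G} A B w → ∀ R → R + 3 ≡ deg u (seg 0 m) → 64 * k < (R + 3) * (R + 3) → 6 ≤ R → 4 ≤ k →
                    HasCycleWithExactlyChords G k
      with-prefix (inj₂ (j , refl)) =
        alternating-cycle [] [] [] [] [] tt (j , refl) (cong (λ b → b2n b + 0 + 0 + 0) w~Q0) z≤n
        where
        w~Q0 : adj G (B j) (Q 0) ≡ true
        w~Q0 = T⇒≡true (subst (E G (B j)) (sym Q0≡A) (E-sym (A~B i₀ j)))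
      with-prefix (inj₁ (j , refl)) =
        alternating-cycle (B (γ 0) ∷ []) (inj₂ (γ 0 , refl) ∷ []) ((B₀≢Q0 , proj₂ (proj₂ (proj₂ pick-B) 0 z≤n)) ∷ [])
          ([] ∷ []) (B₀-disjoint ∷ []) (A~B j (γ 0) , tt) (γ 0 , refl) prefix-edges (s≤s z≤n)
        where
        B₀≢Q0 : B (γ 0) ≢ Q 0
        B₀≢Q0 e = A≢B i₀ (γ 0) (sym (trans e Q0≡A))
        B₀-disjoint : ∀ s → s < k → (B (γ 0) ≢ A (α s)) × (B (γ 0) ≢ B (β s))
        B₀-disjoint s s<k = (λ e → A≢B (α s) (γ 0) (sym e)) , (λ e → 0≢1+n (proj₁ (proj₂ pick-B) 0 (suc s) z≤n s<k (B-injective e)))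
        prefix-edges : b2n (adj G (A j) (Q 0)) + deg (A j) (B (γ 0) ∷ []) + edges (B (γ 0) ∷ []) + deg (Q 0) (B (γ 0) ∷ []) ≡ 1 + 1
        prefix-edges rewrite T⇒≡true (A~B j (γ 0)) | T⇒≡true (subst (λ z → E G z (B (γ 0))) (sym Q0≡A) (A~B i₀ (γ 0)))
                           | ¬T⇒≡false (let (_ , _ , _ , _ , _ , _ , a≁a , _) = K in a≁a j i₀ ∘ subst (E G (A j)) Q0≡A) = refl

  extraction-antitone : ∀ {p S} → IsPExtraction G p S → ∀ {i} j → i ≤ j → j ≤ p → ∀ v → T (S j v) → T (S i v)
  extraction-antitone ext zero z≤n _ v = λ v∈S → v∈S
  extraction-antitone ext (suc j) i≤1+j 1+j≤p v with m≤n⇒m<n∨m≡n i≤1+j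
  ... | inj₂ refl = λ v∈S → v∈S
  ... | inj₁ i<1+j = extraction-antitone ext j (s≤s⁻¹ i<1+j) (<⇒≤ 1+j≤p) v ∘ proj₁ (proj₂ ext j 1+j≤p) v

  module _ {S₁ : VSet G} {ℓ : ℕ} {A B : Fin ℓ → V} (K : IsInducedKll G S₁ ℓ A B) where

    cycle-from-K-end : ∀ {m} (path : UnimodalPath S₁ m) {u w} → E G u w → InK {G} A B w →
      (∀ j → j < m → UnimodalPath.Q path j ≢ u) → (∀ j → j < m → UnimodalPath.Q path j ≢ w) → InK {G} A B (UnimodalPath.Q path 0) →
      ∀ k → k + 4 ≤ ℓ → ∀ R → R + 3 ≡ deg u (UnimodalPath.seg path 0 m) → 64 * k < (R + 3) * (R + 3) → 6 ≤ R → 4 ≤ k →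
      HasCycleWithExactlyChords G k
    cycle-from-K-end path u~w w∈K u∉path w∉path (inj₁ (i₀ , Q0≡A)) =
      cycle-from-A-end K path u~w w∈K u∉path w∉path i₀ Q0≡A
    cycle-from-K-end path u~w w∈K u∉path w∉path (inj₂ (j₀ , Q0≡B)) =
      cycle-from-A-end (swap-Kll {S = S₁} K) path u~w (swap-InK w∈K) u∉path w∉path j₀ Q0≡B

    many-neighbours⇒cycle : ∀ {m} (path : UnimodalPath S₁ m) {u w} → E G u w → InK {G} A B w →
      (∀ j → j < m → UnimodalPath.Q path j ≢ u) → (∀ j → j < m → UnimodalPath.Q path j ≢ w) →
      InK {G} A B (UnimodalPath.Q path 0) ⊎ InK {G} A B (UnimodalPath.Q path (m ∸ 1)) →
      ∀ k → 1 ≤ k → k + 4 ≤ ℓ → 64 * k < deg u (UnimodalPath.seg path 0 m) * deg u (UnimodalPath.seg path 0 m) →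
      HasCycleWithExactlyChords G k
    many-neighbours⇒cycle {m} path {u} u~w w∈K u∉path w∉path end∈K k 1≤k k+4≤ℓ 64k<r*r with k + 3 ≤? deg u (UnimodalPath.seg path 0 m)
    ... | yes k+3≤r = UnimodalPathProperties.fan path k u∉path k+3≤r
    ... | no k+3≰r = through-K end∈K
      where
      r = deg u (UnimodalPath.seg path 0 m)
      9≤r = 64k<r*r⇒9≤r k r 1≤k 64k<r*r
      R = r ∸ 3
      R+3≡r : R + 3 ≡ r
      R+3≡r = m∸n+n≡m (≤-trans (s≤s (s≤s (s≤s z≤n))) 9≤r)
      6≤R : 6 ≤ R
      6≤R = +-cancelʳ-≤ 3 6 R (≤-trans 9≤r (≤-reflexive (sym R+3≡r)))
      4≤k : 4 ≤ k
      4≤k = +-cancelʳ-≤ 3 4 k (≤-trans (m≤n+m 7 2) (≤-trans 9≤r (≤-trans (n≤1+n r) (≰⇒> k+3≰r))))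
      64k<[R+3]² : 64 * k < (R + 3) * (R + 3)
      64k<[R+3]² = subst (λ z → 64 * k < z * z) (sym R+3≡r) 64k<r*r
      through-K : InK {G} A B (UnimodalPath.Q path 0) ⊎ InK {G} A B (UnimodalPath.Q path (m ∸ 1)) → HasCycleWithExactlyChords G k
      through-K (inj₁ start∈K) =
        cycle-from-K-end path u~w w∈K u∉path w∉path start∈K k k+4≤ℓ R R+3≡r 64k<[R+3]² 6≤R 4≤k
      through-K (inj₂ end∈K) =
        cycle-from-K-end (reversePath path) u~w w∈K (reversePath-avoids path u∉path) (reversePath-avoids path w∉path) end∈K
          k k+4≤ℓ R (trans R+3≡r (sym (deg-reversePath path u))) 64k<[R+3]² 6≤R 4≤k

lemma6p4 : (k : ℕ) → 1 ≤ k → Σ ℕ λ ℓ₀ → (ℓ p : ℕ) → ℓ₀ ≤ ℓ → 1 ≤ p →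
    (G : Graph) → (S : ℕ → VSet G) → IsPExtraction G p S →
    (a b : Fin ℓ → Fin (n G)) → IsInducedKll G (S p) ℓ a b →
    (i : ℕ) → (x y : Fin (n G)) → (m : ℕ) → (P : Fin m → Fin (n G)) →
    IsUnimodalInLayer G p S i x y m P → (InK {G} a b x ⊎ InK {G} a b y) →
    (u : Fin (n G)) → (∀ j → P j ≢ u) →
    (Σ (Fin (n G)) λ w → InK {G} a b w × (∀ j → P j ≢ w) × E G u w) →
    HasCycleWithExactlyChords G k
      ⊎ neighboursOnPath G u m P * neighboursOnPath G u m P ≤ 64 * k
lemma6p4 k 1≤k = k + 4 ,
  λ ℓ p k+4≤ℓ _ G S ext a b K i x y m P (i<p , unimodal , _ , _) x∨y∈K u u∉P (w , w∈K , w∉P , u~w) →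
  let open IndexedPath G {S i} {S (suc i)} unimodal
      r = neighboursOnPath G u m P
      r≡deg = sym (deg-indexedPath u)
      K₁ = IsInducedKll-mono G (extraction-antitone G ext p i<p ≤-refl) K
  in case r * r ≤? 64 * k of λ where
    (yes r*r≤64k) → inj₂ r*r≤64k
    (no r*r≰64k) →
      let 64k<r*r = ≰⇒> r*r≰64k
          0<m = <-≤-trans (≤-trans (s≤s z≤n) (64k<r*r⇒9≤r k r 1≤k 64k<r*r))
                          (subst (_≤ m) (sym r≡deg) (UnimodalPathProperties.deg-prefix≤length G indexedPath u m))
          ends = Sum.map (subst (InK {G} a b) (sym (indexedPath-start 0<m)))
                         (subst (InK {G} a b) (sym (indexedPath-end 0<m))) x∨y∈K
      in inj₁ (many-neighbours⇒cycle G K₁ indexedPath u~w w∈K (indexedPath-avoids u∉P) (indexedPath-avoids w∉P)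
                 ends k 1≤k k+4≤ℓ (subst (λ z → 64 * k < z * z) r≡deg 64k<r*r))
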